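{- Let $\mathcal{H}$ be a graded connected Hopf algebra over a field $k$ of characteristic different from $2$. Then $\mathbb{X}_-(\mathcal{H})$ is a set of representatives for both the left and the right cosets of the subgroup $\mathbb{X}_+(\mathcal{H})$ of $\mathbb{X}(\mathcal{H})$. Moreover, \begin{itemize} \item[(a)] $\mathbb{X}_-(\mathcal{H})$ is closed under conjugation by elements of $\mathbb{X}_+(\mathcal{H})$. \item[(b)] If $\varphi,\psi\in\mathbb{X}_-(\mathcal{H})$ and $\varphi\psi=\psi\varphi$, then $\varphi\psi\in\mathbb{X}_-(\mathcal{H})$. \item[(c)] $\mathbb{X}_-(\mathcal{H})$ is closed under integer powers, in particular under inversion. \end{itemize}
   Context: $\mathcal{H}$ is graded connected with finite-dimensional homogeneous components. $\mathbb{X}(\mathcal{H})$ denotes the group of characters (algebra morphisms $\mathcal{H}\to k$) under convolution $\varphi\psi=m_k\circ(\varphi\otimes\psi)\circ\Delta_{\mathcal{H}}$, with unit the counit and inverse $\varphi\circ S_{\mathcal{H}}$. For $h\in\mathcal{H}_n$ put $\overline{\varphi}(h)=(-1)^n\varphi(h)$. $\mathbb{X}_+(\mathcal{H})$ is the subgroup of even characters ($\overline{\varphi}=\varphi$) and $\mathbb{X}_-(\mathcal{H})$ is the set of odd characters ($\overline{\varphi}=\varphi^{ -1}$). -}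

module Defs where

open import Level using (Level; _⊔_) renaming (suc to lsuc)
open import Data.Nat using (ℕ; zero; suc; _≡ᵇ_) renaming (_+_ to _+ℕ_)
open import Data.Fin using (Fin; toℕ)
import Data.Fin as Fin
open import Data.Bool using (if_then_else_; _∧_)
open import Data.Integer using (ℤ; +_; -[1+_])
open import Data.Product using (Σ; ∃; _×_; _,_)
open import Relation.Nullary using (¬_)
open import Relation.Binary.PropositionalEquality using (_≡_; _≢_)
open import Algebra.Bundles using (CommutativeRing)

record Field (c ℓ : Level) : Set (lsuc (c ⊔ ℓ)) where
  field
    commutativeRing : CommutativeRing c ℓ
  open CommutativeRing commutativeRing public
  field
    0≉1     : ¬ (0# ≈ 1#)
    inverse : ∀ x → ¬ (x ≈ 0#) → ∃ λ y → x * y ≈ 1#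

CharNot2 : ∀ {c ℓ} → Field c ℓ → Set ℓ
CharNot2 F = ¬ (1# + 1# ≈ 0#) where open Field F

module Sums {c ℓ} (F : Field c ℓ) where
  open Field F

  ΣFin : (m : ℕ) → (Fin m → Carrier) → Carrier
  ΣFin zero    f = 0#
  ΣFin (suc m) f = f Fin.zero + ΣFin m (λ a → f (Fin.suc a))

  Σ≤ : ℕ → (ℕ → Carrier) → Carrier
  Σ≤ zero    f = f 0
  Σ≤ (suc n) f = f 0 + Σ≤ n (λ i → f (suc i))

  kron : (d : ℕ → ℕ) (j n : ℕ) → Fin (d j) → Fin (d n) → Carrier
  kron d j n b e = if (j ≡ᵇ n) ∧ (toℕ b ≡ᵇ toℕ e) then 1# else 0#

  ext0 : (d : ℕ → ℕ) → (Fin (d 0) → Carrier) → (n : ℕ) → Fin (d n) → Carrier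
  ext0 d f zero    a = f a
  ext0 d f (suc n) a = 0#

  sgn : ℕ → Carrier
  sgn zero    = 1#
  sgn (suc n) = - sgn n

-- Graded connected Hopf algebras with finite-dimensional homogeneous
-- components, presented by structure constants w.r.t. a homogeneous
-- basis:  H = ⊕_n H_n,  H_n has basis e^n_0 … e^n_{dim n - 1}.
--   μ i j n a b c : coefficient of e^n_c in e^i_a · e^j_b
--   δ n i j e a b : coefficient of e^i_a ⊗ e^j_b in Δ(e^n_e)
--   unit a        : coefficient of e^0_a in 1_H   (1_H ∈ H_0)
--   counit a      : ε(e^0_a)                     (ε vanishes on H_n, n>0)
--   S n a b       : coefficient of e^n_b in S(e^n_a) (S is graded)

record GCHopf {c ℓ} (F : Field c ℓ) : Set (c ⊔ ℓ) where
  open Field F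
  open Sums F
  field
    dim    : ℕ → ℕ
    μ      : (i j n : ℕ) → Fin (dim i) → Fin (dim j) → Fin (dim n) → Carrier
    δ      : (n i j : ℕ) → Fin (dim n) → Fin (dim i) → Fin (dim j) → Carrier
    unit   : Fin (dim 0) → Carrier
    counit : Fin (dim 0) → Carrier
    S      : (n : ℕ) → Fin (dim n) → Fin (dim n) → Carrier

  ε̃ : (n : ℕ) → Fin (dim n) → Carrier
  ε̃ = ext0 dim counit
  1̃ : (n : ℕ) → Fin (dim n) → Carrier
  1̃ = ext0 dim unit

  field
    -- connectedness: H_0 = k·1
    connected : dim 0 ≡ 1
    μ-graded : ∀ i j n a b e → n ≢ i +ℕ j → μ i j n a b e ≈ 0#
    δ-graded : ∀ n i j e a b → n ≢ i +ℕ j → δ n i j e a b ≈ 0#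
    assoc : ∀ i j l n (a : Fin (dim i)) (b : Fin (dim j)) (e : Fin (dim l))
              (f : Fin (dim n)) →
            Σ≤ n (λ m → ΣFin (dim m) λ x → μ i j m a b x * μ m l n x e f)
              ≈ Σ≤ n (λ m → ΣFin (dim m) λ x → μ j l m b e x * μ i m n a x f)
    unitˡ : ∀ j n b e → ΣFin (dim 0) (λ a → unit a * μ 0 j n a b e) ≈ kron dim j n b e
    unitʳ : ∀ j n b e → ΣFin (dim 0) (λ a → unit a * μ j 0 n b a e) ≈ kron dim j n b e
    coassoc : ∀ n p q r (e : Fin (dim n)) (x : Fin (dim p)) (y : Fin (dim q))
                (z : Fin (dim r)) →
              Σ≤ n (λ m → ΣFin (dim m) λ w → δ n m r e w z * δ m p q w x y)
                ≈ Σ≤ n (λ m → ΣFin (dim m) λ w → δ n p m e x w * δ m q r w y z)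
    counitˡ : ∀ n m e b → ΣFin (dim 0) (λ a → counit a * δ n 0 m e a b) ≈ kron dim n m e b
    counitʳ : ∀ n m e b → ΣFin (dim 0) (λ a → counit a * δ n m 0 e b a) ≈ kron dim n m e b
    -- bialgebra compatibility: ε and Δ are algebra morphisms
    counit-mult : ∀ i j a b →
                  ΣFin (dim 0) (λ z → μ i j 0 a b z * counit z) ≈ ε̃ i a * ε̃ j b
    counit-unit : ΣFin (dim 0) (λ a → unit a * counit a) ≈ 1#
    δ-unit : ∀ p q x y →
             ΣFin (dim 0) (λ a → unit a * δ 0 p q a x y) ≈ 1̃ p x * 1̃ q y
    δ-mult : ∀ i j p q (a : Fin (dim i)) (b : Fin (dim j)) (x : Fin (dim p))
               (y : Fin (dim q)) →
             Σ≤ (i +ℕ j) (λ m → ΣFin (dim m) λ z → μ i j m a b z * δ m p q z x y)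
               ≈ Σ≤ i (λ p₁ → Σ≤ i (λ q₁ → Σ≤ j (λ p₂ → Σ≤ j (λ q₂ →
                   ΣFin (dim p₁) λ x₁ → ΣFin (dim q₁) λ y₁ →
                   ΣFin (dim p₂) λ x₂ → ΣFin (dim q₂) λ y₂ →
                     δ i p₁ q₁ a x₁ y₁ * δ j p₂ q₂ b x₂ y₂
                       * (μ p₁ p₂ p x₁ x₂ x * μ q₁ q₂ q y₁ y₂ y)))))
    -- antipode: m ∘ (S ⊗ id) ∘ Δ = η ∘ ε = m ∘ (id ⊗ S) ∘ Δ
    antipodeˡ : ∀ n p (e : Fin (dim n)) (f : Fin (dim p)) →
                Σ≤ n (λ i → Σ≤ n (λ j → ΣFin (dim i) λ a → ΣFin (dim j) λ b →
                  ΣFin (dim i) λ a′ → δ n i j e a b * S i a a′ * μ i j p a′ b f))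
                  ≈ ε̃ n e * 1̃ p f
    antipodeʳ : ∀ n p (e : Fin (dim n)) (f : Fin (dim p)) →
                Σ≤ n (λ i → Σ≤ n (λ j → ΣFin (dim i) λ a → ΣFin (dim j) λ b →
                  ΣFin (dim j) λ b′ → δ n i j e a b * S j b b′ * μ i j p a b′ f))
                  ≈ ε̃ n e * 1̃ p f

-- Characters.  A linear functional H → k is given by its values on the
-- homogeneous basis.

module Characters {c ℓ} {F : Field c ℓ} (H : GCHopf F) where
  open Field F
  open Sums F
  open GCHopf H

  Functional : Set c
  Functional = (n : ℕ) → Fin (dim n) → Carrier

  _≋_ : Functional → Functional → Set ℓ
  φ ≋ ψ = ∀ n a → φ n a ≈ ψ n a

  IsCharacter : Functional → Set ℓ
  IsCharacter χ =
    (∀ i j (a : Fin (dim i)) (b : Fin (dim j)) →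
       Σ≤ (i +ℕ j) (λ m → ΣFin (dim m) λ z → μ i j m a b z * χ m z) ≈ χ i a * χ j b)
    × (ΣFin (dim 0) (λ a → unit a * χ 0 a) ≈ 1#)

  -- convolution  φψ = m_k ∘ (φ ⊗ ψ) ∘ Δ
  _⋆_ : Functional → Functional → Functional
  (φ ⋆ ψ) n e = Σ≤ n λ i → Σ≤ n λ j → ΣFin (dim i) λ a → ΣFin (dim j) λ b →
                  δ n i j e a b * φ i a * ψ j b

  -- inverse  φ⁻¹ = φ ∘ S
  _⁻¹ : Functional → Functional
  (φ ⁻¹) n e = ΣFin (dim n) λ a → S n e a * φ n a

  _^ℕ_ : Functional → ℕ → Functional
  φ ^ℕ zero  = ε̃
  φ ^ℕ suc k = φ ⋆ (φ ^ℕ k)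

  _^ℤ_ : Functional → ℤ → Functional
  φ ^ℤ (+ k)     = φ ^ℕ k
  φ ^ℤ -[1+ k ]  = (φ ⁻¹) ^ℕ suc k

  bar : Functional → Functional
  bar φ n a = sgn n * φ n a

  X₊ : Functional → Set ℓ
  X₊ φ = IsCharacter φ × (bar φ ≋ φ)

  X₋ : Functional → Set ℓ
  X₋ φ = IsCharacter φ × (bar φ ≋ (φ ⁻¹))

{-# OPTIONS --safe #-}
module Submission where

-- The characters form a group under ⋆, inverses coming from the antipode, and φ ↦ φ̄ is an
-- involutive automorphism of it, induced by the grading automorphism (-1)ⁿ of H.  For normalised
-- functionals (φ = ε on H₀) the degree-n part of φ ⋆ φ is 2φₙ plus terms of lower degree, so, 2
-- being invertible, squaring is injective and square roots can be built degree by degree.  A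
-- square root of a character is a character: in the lowest degree where σ fails to be
-- multiplicative, the multiplicativity defect of σ ⋆ σ is twice that of σ.  The rest is group
-- theory.  With ψ := √(φ φ̄⁻¹), ψ is odd and ψ⁻¹φ even.  If ψ and ψρ are odd and ρ is even, then
-- ψ⁻¹ρ = ρ⁻¹ψ⁻¹, so (ρψ⁻¹)² = ψ⁻², and injectivity of squaring forces ρ = ε.

open import Defs
open import Algebra.Bundles using (Group)
open import Algebra.Definitions using (Involutive)
open import Algebra.Morphism.Structures using (IsGroupHomomorphism)
open import Data.Bool using (true; if_then_else_)
open import Data.Empty using (⊥-elim)
open import Data.Fin using (Fin; toℕ)
import Data.Fin as Fin
open import Data.Integer using (ℤ; +_; -[1+_])
open import Data.Nat using (ℕ; zero; suc; _≤_; _<_; z≤n; s≤s; _≡ᵇ_) renaming (_+_ to _+ℕ_)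
open import Data.Nat.Induction using (<-rec)
open import Data.Nat.Properties
  using ( _≟_; ≤-refl; ≤-pred; <-trans; <-≤-trans; <-irrefl; <⇒≢; ≤∧≢⇒<; n<1+n; m<1+n⇒m<n∨m≡n
        ; m≤m+n; m≤n+m; m<m+n; m<n+m; n≢0⇒n>0; +-mono-≤; +-mono-<-≤; +-monoʳ-<; suc-injective )
  renaming (+-identityʳ to +-identityʳ-ℕ)
open import Data.Product using (Σ; ∃; ∃₂; _×_; _,_; proj₁; proj₂)
open import Data.Sum using (_⊎_; inj₁; inj₂; [_,_])
open import Function using (_∘_)
open import Level using (_⊔_)
open import Relation.Nullary using (yes; no)
open import Relation.Binary.PropositionalEquality using (_≡_; _≢_; cong; subst)
  renaming (refl to ≡-refl; sym to sym-≡; trans to trans-≡)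

module GroupTheory {g ℓ} (G : Group g ℓ) where
  open Group G
  open import Algebra.Properties.Group G
  open import Algebra.Properties.Monoid monoid using (insertˡ; cancelˡ; cancelʳ)
  open import Algebra.Definitions.RawMonoid rawMonoid public using () renaming (_×_ to _·_)
  open import Relation.Binary.Reasoning.Setoid setoid

  inverse-conjugate⇒ε : (∀ x y → x ∙ x ≈ y ∙ y → x ≈ y) →
                        ∀ {x y} → x ∙ y ≈ y ⁻¹ ∙ x → y ≈ ε
  inverse-conjugate⇒ε square-injective {x} {y} xy≈y⁻¹x = identityˡ-unique y x (square-injective (y ∙ x) x squares)
    where
    squares : (y ∙ x) ∙ (y ∙ x) ≈ x ∙ x
    squares = begin
      (y ∙ x) ∙ (y ∙ x)     ≈⟨ assoc y x (y ∙ x) ⟩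
      y ∙ (x ∙ (y ∙ x))     ≈⟨ ∙-congˡ (sym (assoc x y x)) ⟩
      y ∙ ((x ∙ y) ∙ x)     ≈⟨ ∙-congˡ (∙-congʳ xy≈y⁻¹x) ⟩
      y ∙ ((y ⁻¹ ∙ x) ∙ x)  ≈⟨ ∙-congˡ (assoc (y ⁻¹) x x) ⟩
      y ∙ (y ⁻¹ ∙ (x ∙ x))  ≈⟨ cancelˡ (inverseʳ y) (x ∙ x) ⟩
      x ∙ x                 ∎

  x∙n·x≈n·x∙x : ∀ n x → x ∙ (n · x) ≈ (n · x) ∙ x
  x∙n·x≈n·x∙x zero    x = trans (identityʳ x) (sym (identityˡ x))
  x∙n·x≈n·x∙x (suc n) x = trans (∙-congˡ (x∙n·x≈n·x∙x n x)) (sym (assoc x (n · x) x))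

  module EvenOdd (θ : Carrier → Carrier) (θ-hom : IsGroupHomomorphism rawGroup rawGroup θ) where
    open IsGroupHomomorphism θ-hom using (⁻¹-homo; ε-homo) renaming (homo to θ-∙; ⟦⟧-cong to θ-cong)

    Even Odd : Carrier → Set ℓ
    Even x = θ x ≈ x
    Odd  x = θ x ≈ x ⁻¹

    even-⁻¹ : ∀ {x} → Even x → Even (x ⁻¹)
    even-⁻¹ {x} θx≈x = trans (⁻¹-homo x) (⁻¹-cong θx≈x)

    odd-⁻¹ : ∀ {x} → Odd x → Odd (x ⁻¹)
    odd-⁻¹ {x} θx≈x⁻¹ = trans (⁻¹-homo x) (⁻¹-cong θx≈x⁻¹)

    odd-∙-comm : ∀ {x y} → Odd x → Odd y → x ∙ y ≈ y ∙ x → Odd (x ∙ y)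
    odd-∙-comm {x} {y} odd-x odd-y xy≈yx = begin
      θ (x ∙ y)      ≈⟨ θ-∙ x y ⟩
      θ x ∙ θ y      ≈⟨ ∙-cong odd-x odd-y ⟩
      x ⁻¹ ∙ y ⁻¹    ≈⟨ ⁻¹-anti-homo-∙ y x ⟨
      (y ∙ x) ⁻¹     ≈⟨ ⁻¹-cong xy≈yx ⟨
      (x ∙ y) ⁻¹     ∎

    odd-conjugate : ∀ {r x} → Even r → Odd x → Odd (r ∙ x ∙ r ⁻¹)
    odd-conjugate {r} {x} even-r odd-x = begin
      θ (r ∙ x ∙ r ⁻¹)          ≈⟨ θ-∙ (r ∙ x) (r ⁻¹) ⟩
      θ (r ∙ x) ∙ θ (r ⁻¹)      ≈⟨ ∙-cong (θ-∙ r x) (even-⁻¹ even-r) ⟩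
      θ r ∙ θ x ∙ r ⁻¹          ≈⟨ ∙-congʳ (∙-cong even-r odd-x) ⟩
      r ∙ x ⁻¹ ∙ r ⁻¹           ≈⟨ ∙-congʳ (∙-congʳ (⁻¹-involutive r)) ⟨
      r ⁻¹ ⁻¹ ∙ x ⁻¹ ∙ r ⁻¹     ≈⟨ ∙-congʳ (⁻¹-anti-homo-∙ x (r ⁻¹)) ⟨
      (x ∙ r ⁻¹) ⁻¹ ∙ r ⁻¹      ≈⟨ ⁻¹-anti-homo-∙ r (x ∙ r ⁻¹) ⟨
      (r ∙ (x ∙ r ⁻¹)) ⁻¹       ≈⟨ ⁻¹-cong (assoc r x (r ⁻¹)) ⟨
      (r ∙ x ∙ r ⁻¹) ⁻¹         ∎

    odd-· : ∀ {x} → Odd x → ∀ n → Odd (n · x)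
    odd-· odd-x zero    = trans ε-homo (sym ε⁻¹≈ε)
    odd-· odd-x (suc n) = odd-∙-comm odd-x (odd-· odd-x n) (x∙n·x≈n·x∙x n _)

    module Uniqueness (square-injective : ∀ x y → x ∙ x ≈ y ∙ y → x ≈ y) where

      odd-even-uniqueˡ : ∀ {ψ ψ′ ρ} → Odd ψ → Odd ψ′ → Even ρ → ψ′ ≈ ψ ∙ ρ → ψ ≈ ψ′
      odd-even-uniqueˡ {ψ} {ψ′} {ρ} odd-ψ odd-ψ′ even-ρ ψ′≈ψρ = begin
        ψ        ≈⟨ identityʳ ψ ⟨
        ψ ∙ ε    ≈⟨ ∙-congˡ ρ≈ε ⟨
        ψ ∙ ρ    ≈⟨ ψ′≈ψρ ⟨
        ψ′       ∎
        where
        ρ≈ε : ρ ≈ ε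
        ρ≈ε = inverse-conjugate⇒ε square-injective (begin
          ψ ⁻¹ ∙ ρ        ≈⟨ ∙-cong odd-ψ even-ρ ⟨
          θ ψ ∙ θ ρ       ≈⟨ θ-∙ ψ ρ ⟨
          θ (ψ ∙ ρ)       ≈⟨ θ-cong ψ′≈ψρ ⟨
          θ ψ′            ≈⟨ odd-ψ′ ⟩
          ψ′ ⁻¹           ≈⟨ ⁻¹-cong ψ′≈ψρ ⟩
          (ψ ∙ ρ) ⁻¹      ≈⟨ ⁻¹-anti-homo-∙ ψ ρ ⟩
          ρ ⁻¹ ∙ ψ ⁻¹     ∎)

      odd-even-uniqueʳ : ∀ {ψ ψ′ ρ} → Odd ψ → Odd ψ′ → Even ρ → ψ′ ≈ ρ ∙ ψ → ψ ≈ ψ′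
      odd-even-uniqueʳ {ψ} {ψ′} {ρ} odd-ψ odd-ψ′ even-ρ ψ′≈ρψ =
        ⁻¹-injective (odd-even-uniqueˡ (odd-⁻¹ odd-ψ) (odd-⁻¹ odd-ψ′) (even-⁻¹ even-ρ)
                       (trans (⁻¹-cong ψ′≈ρψ) (⁻¹-anti-homo-∙ ρ ψ)))

    module Existence (square-injective : ∀ x y → x ∙ x ≈ y ∙ y → x ≈ y) (θ-involutive : Involutive _≈_ θ)
                     (square-root : ∀ x → ∃ λ y → y ∙ y ≈ x) where

      odd-even-factorˡ : ∀ x → ∃₂ λ ψ ρ → Odd ψ × Even ρ × x ≈ ψ ∙ ρ
      odd-even-factorˡ x = y , y ⁻¹ ∙ x , odd-y , even-y⁻¹x , insertˡ (inverseʳ y) x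
        where
        y : Carrier
        y = proj₁ (square-root (x ∙ θ x ⁻¹))
        yy≈xθx⁻¹ : y ∙ y ≈ x ∙ θ x ⁻¹
        yy≈xθx⁻¹ = proj₂ (square-root (x ∙ θ x ⁻¹))
        odd-y : Odd y
        odd-y = square-injective (θ y) (y ⁻¹) (begin
          θ y ∙ θ y               ≈⟨ θ-∙ y y ⟨
          θ (y ∙ y)               ≈⟨ θ-cong yy≈xθx⁻¹ ⟩
          θ (x ∙ θ x ⁻¹)          ≈⟨ θ-∙ x (θ x ⁻¹) ⟩
          θ x ∙ θ (θ x ⁻¹)        ≈⟨ ∙-congˡ (trans (⁻¹-homo (θ x)) (⁻¹-cong (θ-involutive x))) ⟩
          θ x ∙ x ⁻¹              ≈⟨ ∙-congʳ (⁻¹-involutive (θ x)) ⟨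
          θ x ⁻¹ ⁻¹ ∙ x ⁻¹        ≈⟨ ⁻¹-anti-homo-∙ x (θ x ⁻¹) ⟨
          (x ∙ θ x ⁻¹) ⁻¹         ≈⟨ ⁻¹-cong yy≈xθx⁻¹ ⟨
          (y ∙ y) ⁻¹              ≈⟨ ⁻¹-anti-homo-∙ y y ⟩
          y ⁻¹ ∙ y ⁻¹             ∎)
        even-y⁻¹x : Even (y ⁻¹ ∙ x)
        even-y⁻¹x = begin
          θ (y ⁻¹ ∙ x)              ≈⟨ θ-∙ (y ⁻¹) x ⟩
          θ (y ⁻¹) ∙ θ x            ≈⟨ ∙-congʳ (trans (odd-⁻¹ odd-y) (⁻¹-involutive y)) ⟩
          y ∙ θ x                   ≈⟨ cancelˡ (inverseˡ y) (y ∙ θ x) ⟨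
          y ⁻¹ ∙ (y ∙ (y ∙ θ x))    ≈⟨ ∙-congˡ (assoc y y (θ x)) ⟨
          y ⁻¹ ∙ ((y ∙ y) ∙ θ x)    ≈⟨ ∙-congˡ (∙-congʳ yy≈xθx⁻¹) ⟩
          y ⁻¹ ∙ ((x ∙ θ x ⁻¹) ∙ θ x) ≈⟨ ∙-congˡ (cancelʳ (inverseˡ (θ x)) x) ⟩
          y ⁻¹ ∙ x                  ∎

      odd-even-factorʳ : ∀ x → ∃₂ λ ψ ρ → Odd ψ × Even ρ × x ≈ ρ ∙ ψ
      odd-even-factorʳ x with odd-even-factorˡ (x ⁻¹)
      ... | ψ , ρ , odd-ψ , even-ρ , x⁻¹≈ψρ = ψ ⁻¹ , ρ ⁻¹ , odd-⁻¹ odd-ψ , even-⁻¹ even-ρ , (begin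
        x               ≈⟨ ⁻¹-involutive x ⟨
        x ⁻¹ ⁻¹         ≈⟨ ⁻¹-cong x⁻¹≈ψρ ⟩
        (ψ ∙ ρ) ⁻¹      ≈⟨ ⁻¹-anti-homo-∙ ψ ρ ⟩
        ρ ⁻¹ ∙ ψ ⁻¹     ∎)

module SumsProperties {c ℓ} (F : Field c ℓ) where
  open Field F hiding (zero)
  open Sums F
  open import Algebra.Properties.CommutativeSemigroup +-commutativeSemigroup using (interchange)
  open import Algebra.Properties.AbelianGroup +-abelianGroup using (xyx⁻¹≈y)
  open import Algebra.Properties.Group +-group using (⁻¹-involutive)
  open import Algebra.Properties.Ring ring using (-‿distribˡ-*; -‿distribʳ-*)
  open import Relation.Binary.Reasoning.Setoid setoid

  y+[x-y]≈x : ∀ x y → y + (x - y) ≈ x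
  y+[x-y]≈x x y = trans (sym (+-assoc y x (- y))) (xyx⁻¹≈y y x)

  ΣFin-cong : ∀ m {f g : Fin m → Carrier} → (∀ a → f a ≈ g a) → ΣFin m f ≈ ΣFin m g
  ΣFin-cong zero    f≈g = refl
  ΣFin-cong (suc m) f≈g = +-cong (f≈g Fin.zero) (ΣFin-cong m (f≈g ∘ Fin.suc))

  ΣFin-zero : ∀ m {f : Fin m → Carrier} → (∀ a → f a ≈ 0#) → ΣFin m f ≈ 0#
  ΣFin-zero zero    f≈0 = refl
  ΣFin-zero (suc m) f≈0 = trans (+-cong (f≈0 Fin.zero) (ΣFin-zero m (f≈0 ∘ Fin.suc))) (+-identityʳ 0#)

  ΣFin-distrib-+ : ∀ m (f g : Fin m → Carrier) → ΣFin m (λ a → f a + g a) ≈ ΣFin m f + ΣFin m g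
  ΣFin-distrib-+ zero    f g = sym (+-identityʳ 0#)
  ΣFin-distrib-+ (suc m) f g = trans (+-congˡ (ΣFin-distrib-+ m _ _)) (interchange _ _ _ _)

  *-distribˡ-ΣFin : ∀ m x (f : Fin m → Carrier) → x * ΣFin m f ≈ ΣFin m (λ a → x * f a)
  *-distribˡ-ΣFin zero    x f = zeroʳ x
  *-distribˡ-ΣFin (suc m) x f = trans (distribˡ x _ _) (+-congˡ (*-distribˡ-ΣFin m x _))

  *-distribʳ-ΣFin : ∀ m x (f : Fin m → Carrier) → ΣFin m f * x ≈ ΣFin m (λ a → f a * x)
  *-distribʳ-ΣFin zero    x f = zeroˡ x
  *-distribʳ-ΣFin (suc m) x f = trans (distribʳ x _ _) (+-congˡ (*-distribʳ-ΣFin m x _))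

  ΣFin-sandwich : ∀ m x y (f : Fin m → Carrier) → ΣFin m (λ a → x * f a * y) ≈ x * ΣFin m f * y
  ΣFin-sandwich m x y f = sym (trans (*-congʳ (*-distribˡ-ΣFin m x f)) (*-distribʳ-ΣFin m y _))

  ΣFin-comm : ∀ m k (f : Fin m → Fin k → Carrier) →
              ΣFin m (λ a → ΣFin k (f a)) ≈ ΣFin k (λ b → ΣFin m (λ a → f a b))
  ΣFin-comm zero    k f = sym (ΣFin-zero k (λ _ → refl))
  ΣFin-comm (suc m) k f = trans (+-congˡ (ΣFin-comm m k _)) (sym (ΣFin-distrib-+ k _ _))

  Σ≤-cong : ∀ n {f g : ℕ → Carrier} → (∀ i → i ≤ n → f i ≈ g i) → Σ≤ n f ≈ Σ≤ n g
  Σ≤-cong zero    f≈g = f≈g 0 z≤n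
  Σ≤-cong (suc n) f≈g = +-cong (f≈g 0 z≤n) (Σ≤-cong n (λ i i≤n → f≈g (suc i) (s≤s i≤n)))

  Σ≤-zero : ∀ n {f : ℕ → Carrier} → (∀ i → i ≤ n → f i ≈ 0#) → Σ≤ n f ≈ 0#
  Σ≤-zero zero    f≈0 = f≈0 0 z≤n
  Σ≤-zero (suc n) f≈0 =
    trans (+-cong (f≈0 0 z≤n) (Σ≤-zero n (λ i i≤n → f≈0 (suc i) (s≤s i≤n)))) (+-identityʳ 0#)

  Σ≤-distrib-+ : ∀ n (f g : ℕ → Carrier) → Σ≤ n (λ i → f i + g i) ≈ Σ≤ n f + Σ≤ n g
  Σ≤-distrib-+ zero    f g = refl
  Σ≤-distrib-+ (suc n) f g = trans (+-congˡ (Σ≤-distrib-+ n _ _)) (interchange _ _ _ _)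

  *-distribˡ-Σ≤ : ∀ n x (f : ℕ → Carrier) → x * Σ≤ n f ≈ Σ≤ n (λ i → x * f i)
  *-distribˡ-Σ≤ zero    x f = refl
  *-distribˡ-Σ≤ (suc n) x f = trans (distribˡ x _ _) (+-congˡ (*-distribˡ-Σ≤ n x _))

  *-distribʳ-Σ≤ : ∀ n x (f : ℕ → Carrier) → Σ≤ n f * x ≈ Σ≤ n (λ i → f i * x)
  *-distribʳ-Σ≤ zero    x f = refl
  *-distribʳ-Σ≤ (suc n) x f = trans (distribʳ x _ _) (+-congˡ (*-distribʳ-Σ≤ n x _))

  Σ≤-ΣFin-comm : ∀ n k (f : ℕ → Fin k → Carrier) →
                 Σ≤ n (λ i → ΣFin k (f i)) ≈ ΣFin k (λ b → Σ≤ n (λ i → f i b))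
  Σ≤-ΣFin-comm zero    k f = refl
  Σ≤-ΣFin-comm (suc n) k f = trans (+-congˡ (Σ≤-ΣFin-comm n k _)) (sym (ΣFin-distrib-+ k _ _))

  Σ≤-comm : ∀ n k (f : ℕ → ℕ → Carrier) →
            Σ≤ n (λ i → Σ≤ k (f i)) ≈ Σ≤ k (λ j → Σ≤ n (λ i → f i j))
  Σ≤-comm zero    k f = refl
  Σ≤-comm (suc n) k f = trans (+-congˡ (Σ≤-comm n k _)) (sym (Σ≤-distrib-+ k _ _))

  Σ≤-single : ∀ n k (f : ℕ → Carrier) → k ≤ n → (∀ i → i ≤ n → i ≢ k → f i ≈ 0#) → Σ≤ n f ≈ f k
  Σ≤-single zero    zero    f z≤n       f≈0 = refl
  Σ≤-single (suc n) zero    f z≤n       f≈0 =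
    trans (+-congˡ (Σ≤-zero n (λ i i≤n → f≈0 (suc i) (s≤s i≤n) λ ()))) (+-identityʳ _)
  Σ≤-single (suc n) (suc k) f (s≤s k≤n) f≈0 =
    trans (+-cong (f≈0 0 z≤n λ ()) (Σ≤-single n k (f ∘ suc) k≤n
            (λ i i≤n i≢k → f≈0 (suc i) (s≤s i≤n) (i≢k ∘ suc-injective))))
          (+-identityˡ _)

  Σ≤-extend : ∀ m n (f : ℕ → Carrier) → m ≤ n → (∀ i → m < i → i ≤ n → f i ≈ 0#) → Σ≤ m f ≈ Σ≤ n f
  Σ≤-extend zero    zero    f z≤n       f≈0 = refl
  Σ≤-extend zero    (suc n) f z≤n       f≈0 =
    sym (trans (+-congˡ (Σ≤-zero n (λ i i≤n → f≈0 (suc i) (s≤s z≤n) (s≤s i≤n)))) (+-identityʳ _))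
  Σ≤-extend (suc m) (suc n) f (s≤s m≤n) f≈0 =
    +-congˡ (Σ≤-extend m n (f ∘ suc) m≤n (λ i m<i i≤n → f≈0 (suc i) (s≤s m<i) (s≤s i≤n)))

  ΣFin-singleton : ∀ {m} (m≡1 : m ≡ 1) (f : Fin m → Carrier) →
                   ΣFin m f ≈ f (subst Fin (sym-≡ m≡1) Fin.zero)
  ΣFin-singleton ≡-refl f = +-identityʳ _

  ≡ᵇ-refl : ∀ n → (n ≡ᵇ n) ≡ true
  ≡ᵇ-refl zero    = ≡-refl
  ≡ᵇ-refl (suc n) = ≡ᵇ-refl n

  ΣFin-kron : ∀ (d : ℕ → ℕ) n (e : Fin (d n)) (g : Fin (d n) → Carrier) →
              ΣFin (d n) (λ b → kron d n n e b * g b) ≈ g e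
  ΣFin-kron d n e g rewrite ≡ᵇ-refl n = go e g
    where
    go : ∀ {m} (e : Fin m) (g : Fin m → Carrier) →
         ΣFin m (λ b → (if toℕ e ≡ᵇ toℕ b then 1# else 0#) * g b) ≈ g e
    go {suc m} Fin.zero    g = trans (+-cong (*-identityˡ _) (ΣFin-zero m (λ b → zeroˡ _))) (+-identityʳ _)
    go {suc m} (Fin.suc e) g = trans (+-cong (zeroˡ _) (go e (g ∘ Fin.suc))) (+-identityˡ _)

  sgn-+ : ∀ i j → sgn (i +ℕ j) ≈ sgn i * sgn j
  sgn-+ zero    j = sym (*-identityˡ _)
  sgn-+ (suc i) j = trans (-‿cong (sgn-+ i j)) (-‿distribˡ-* _ _)

  sgn-sgn : ∀ n → sgn n * sgn n ≈ 1#
  sgn-sgn zero    = *-identityˡ _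
  sgn-sgn (suc n) = begin
    - sgn n * - sgn n      ≈⟨ -‿distribˡ-* _ _ ⟨
    - (sgn n * - sgn n)    ≈⟨ -‿cong (-‿distribʳ-* _ _) ⟨
    - - (sgn n * sgn n)    ≈⟨ ⁻¹-involutive _ ⟩
    sgn n * sgn n          ≈⟨ sgn-sgn n ⟩
    1#                     ∎

module Convolution {c ℓ} {F : Field c ℓ} (H : GCHopf F) where
  open Field F hiding (zero)
  open Sums F
  open SumsProperties F
  open GCHopf H
  open Characters H
  open import Algebra.Solver.CommutativeMonoid *-commutativeMonoid using (solve; _⊜_) renaming (_⊕_ to _·_)
  open import Algebra.Properties.Group +-group using (x≈y⇒x∙y⁻¹≈ε)
  open import Algebra.Properties.CommutativeSemigroup *-commutativeSemigroup using (x∙yz≈y∙xz)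
  open import Relation.Binary.Reasoning.Setoid setoid

  Σᴴ : ℕ → ((i : ℕ) → Fin (dim i) → Carrier) → Carrier
  Σᴴ n f = Σ≤ n (λ i → ΣFin (dim i) (f i))

  Σᴴ-cong : ∀ n {f g : (i : ℕ) → Fin (dim i) → Carrier} →
            (∀ i → i ≤ n → ∀ a → f i a ≈ g i a) → Σᴴ n f ≈ Σᴴ n g
  Σᴴ-cong n f≈g = Σ≤-cong n (λ i i≤n → ΣFin-cong (dim i) (f≈g i i≤n))

  Σᴴ-zero : ∀ n {f : (i : ℕ) → Fin (dim i) → Carrier} →
            (∀ i → i ≤ n → ∀ a → f i a ≈ 0#) → Σᴴ n f ≈ 0#
  Σᴴ-zero n f≈0 = Σ≤-zero n (λ i i≤n → ΣFin-zero (dim i) (f≈0 i i≤n))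

  Σᴴ-distrib-+ : ∀ n (f g : (i : ℕ) → Fin (dim i) → Carrier) →
                 Σᴴ n (λ i a → f i a + g i a) ≈ Σᴴ n f + Σᴴ n g
  Σᴴ-distrib-+ n f g = trans (Σ≤-cong n (λ i _ → ΣFin-distrib-+ (dim i) _ _)) (Σ≤-distrib-+ n _ _)

  *-distribˡ-Σᴴ : ∀ n x (f : (i : ℕ) → Fin (dim i) → Carrier) → x * Σᴴ n f ≈ Σᴴ n (λ i a → x * f i a)
  *-distribˡ-Σᴴ n x f = trans (*-distribˡ-Σ≤ n x _) (Σ≤-cong n (λ i _ → *-distribˡ-ΣFin (dim i) x _))

  *-distribʳ-Σᴴ : ∀ n x (f : (i : ℕ) → Fin (dim i) → Carrier) → Σᴴ n f * x ≈ Σᴴ n (λ i a → f i a * x)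
  *-distribʳ-Σᴴ n x f = trans (*-distribʳ-Σ≤ n x _) (Σ≤-cong n (λ i _ → *-distribʳ-ΣFin (dim i) x _))

  ΣFin-Σᴴ-comm : ∀ k n (f : Fin k → (i : ℕ) → Fin (dim i) → Carrier) →
                 ΣFin k (λ b → Σᴴ n (f b)) ≈ Σᴴ n (λ i a → ΣFin k (λ b → f b i a))
  ΣFin-Σᴴ-comm k n f = trans (sym (Σ≤-ΣFin-comm n k _)) (Σ≤-cong n (λ i _ → ΣFin-comm k (dim i) _))

  Σ≤-Σᴴ-comm : ∀ k n (f : ℕ → (i : ℕ) → Fin (dim i) → Carrier) →
               Σ≤ k (λ j → Σᴴ n (f j)) ≈ Σᴴ n (λ i a → Σ≤ k (λ j → f j i a))
  Σ≤-Σᴴ-comm k n f = trans (Σ≤-comm k n _) (Σ≤-cong n (λ i _ → Σ≤-ΣFin-comm k (dim i) _))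

  Σᴴ-comm : ∀ m n (f : (i : ℕ) → Fin (dim i) → (j : ℕ) → Fin (dim j) → Carrier) →
            Σᴴ m (λ i a → Σᴴ n (f i a)) ≈ Σᴴ n (λ j b → Σᴴ m (λ i a → f i a j b))
  Σᴴ-comm m n f = trans (Σ≤-cong m (λ i _ → ΣFin-Σᴴ-comm (dim i) n (f i))) (Σ≤-Σᴴ-comm m n _)

  Σᴴ²-distrib-+ : ∀ n {h f g : (i : ℕ) → Fin (dim i) → (j : ℕ) → Fin (dim j) → Carrier} →
                  (∀ i a j b → h i a j b ≈ f i a j b + g i a j b) →
                  Σᴴ n (λ i a → Σᴴ n (h i a)) ≈ Σᴴ n (λ i a → Σᴴ n (f i a)) + Σᴴ n (λ i a → Σᴴ n (g i a))
  Σᴴ²-distrib-+ n h≈f+g =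
    trans (Σᴴ-cong n (λ i _ a → trans (Σᴴ-cong n (λ j _ b → h≈f+g i a j b)) (Σᴴ-distrib-+ n _ _))) (Σᴴ-distrib-+ n _ _)

  Σᴴ-extend : ∀ m n (f : (i : ℕ) → Fin (dim i) → Carrier) → m ≤ n →
              (∀ i → m < i → i ≤ n → ∀ a → f i a ≈ 0#) → Σᴴ m f ≈ Σᴴ n f
  Σᴴ-extend m n f m≤n f≈0 = Σ≤-extend m n _ m≤n (λ i m<i i≤n → ΣFin-zero (dim i) (f≈0 i m<i i≤n))

  Σ⋆ : ℕ → ((i j : ℕ) → Fin (dim i) → Fin (dim j) → Carrier) → Carrier
  Σ⋆ n T = Σ≤ n (λ i → Σ≤ n (λ j → ΣFin (dim i) (λ a → ΣFin (dim j) (T i j a))))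

  Σ⋆-cong : ∀ n {T U : (i j : ℕ) → Fin (dim i) → Fin (dim j) → Carrier} →
            (∀ i j → i ≤ n → j ≤ n → ∀ a b → T i j a b ≈ U i j a b) → Σ⋆ n T ≈ Σ⋆ n U
  Σ⋆-cong n T≈U = Σ≤-cong n (λ i i≤n → Σ≤-cong n (λ j j≤n → ΣFin-cong (dim i) (λ a → ΣFin-cong (dim j) (T≈U i j i≤n j≤n a))))

  *-distribʳ-Σ⋆ : ∀ n x (T : (i j : ℕ) → Fin (dim i) → Fin (dim j) → Carrier) →
                  Σ⋆ n T * x ≈ Σ⋆ n (λ i j a b → T i j a b * x)
  *-distribʳ-Σ⋆ n x T = trans (*-distribʳ-Σ≤ n x _) (Σ≤-cong n (λ i _ → trans (*-distribʳ-Σ≤ n x _) (Σ≤-cong n (λ j _ →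
                          trans (*-distribʳ-ΣFin (dim i) x _) (ΣFin-cong (dim i) (λ a → *-distribʳ-ΣFin (dim j) x _))))))

  Σ⋆-Σᴴ-comm : ∀ n m (T : (i j : ℕ) → Fin (dim i) → Fin (dim j) → (p : ℕ) → Fin (dim p) → Carrier) →
               Σ⋆ n (λ i j a b → Σᴴ m (T i j a b)) ≈ Σᴴ m (λ p f → Σ⋆ n (λ i j a b → T i j a b p f))
  Σ⋆-Σᴴ-comm n m T = trans (Σ≤-cong n (λ i _ → trans (Σ≤-cong n (λ j _ →
                       trans (ΣFin-cong (dim i) (λ a → ΣFin-Σᴴ-comm (dim j) m _)) (ΣFin-Σᴴ-comm (dim i) m _)))
                       (Σ≤-Σᴴ-comm n m _))) (Σ≤-Σᴴ-comm n m _)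

  δ-off : ∀ {n i j e a b} → n ≢ i +ℕ j → ∀ x y → δ n i j e a b * x * y ≈ 0#
  δ-off {n} {i} {j} {e} {a} {b} n≢i+j x y =
    trans (*-congʳ (trans (*-congʳ (δ-graded n i j e a b n≢i+j)) (zeroˡ x))) (zeroˡ y)

  δ-term-zero : ∀ {n i j e a b x y} → (n ≡ i +ℕ j → x ≈ 0# ⊎ y ≈ 0#) → δ n i j e a b * x * y ≈ 0#
  δ-term-zero {n} {i} {j} factor-zero with n ≟ i +ℕ j
  ... | no n≢i+j = δ-off n≢i+j _ _
  ... | yes n≡i+j = [ (λ x≈0 → trans (*-congʳ (trans (*-congˡ x≈0) (zeroʳ _))) (zeroˡ _))
                    , (λ y≈0 → trans (*-congˡ y≈0) (zeroʳ _)) ] (factor-zero n≡i+j)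

  ⋆-Σᴴ : ∀ {n N} (φ ψ : Functional) e → n ≤ N →
         (φ ⋆ ψ) n e ≈ Σᴴ N (λ i a → Σᴴ N (λ j b → δ n i j e a b * φ i a * ψ j b))
  ⋆-Σᴴ {n} {N} φ ψ e n≤N = begin
    (φ ⋆ ψ) n e
      ≈⟨ Σ≤-cong n (λ i _ → Σ≤-ΣFin-comm n (dim i) _) ⟩
    Σᴴ n (λ i a → Σᴴ n (λ j b → term i a j b))
      ≈⟨ Σᴴ-cong n (λ i _ a → Σᴴ-extend n N _ n≤N (λ j n<j _ b → term-zero (<⇒≢ (<-≤-trans n<j (m≤n+m j i))))) ⟩
    Σᴴ n (λ i a → Σᴴ N (λ j b → term i a j b))
      ≈⟨ Σᴴ-extend n N _ n≤N (λ i n<i _ a → Σᴴ-zero N (λ j _ b → term-zero (<⇒≢ (<-≤-trans n<i (m≤m+n i j))))) ⟩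
    Σᴴ N (λ i a → Σᴴ N (λ j b → term i a j b)) ∎
    where
    term : (i : ℕ) → Fin (dim i) → (j : ℕ) → Fin (dim j) → Carrier
    term i a j b = δ n i j e a b * φ i a * ψ j b
    term-zero : ∀ {i a j b} → n ≢ i +ℕ j → term i a j b ≈ 0#
    term-zero n≢i+j = δ-off n≢i+j _ _

  Normalised : Functional → Set ℓ
  Normalised φ = ∀ a → φ 0 a ≈ counit a

  counit-⋆ˡ : ∀ n e (g : Fin (dim n) → Carrier) →
              ΣFin (dim 0) (λ a → ΣFin (dim n) (λ b → δ n 0 n e a b * counit a * g b)) ≈ g e
  counit-⋆ˡ n e g = begin
    ΣFin (dim 0) (λ a → ΣFin (dim n) (λ b → δ n 0 n e a b * counit a * g b))
      ≈⟨ ΣFin-comm (dim 0) (dim n) _ ⟩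
    ΣFin (dim n) (λ b → ΣFin (dim 0) (λ a → δ n 0 n e a b * counit a * g b))
      ≈⟨ ΣFin-cong (dim n) (λ b → ΣFin-cong (dim 0) (λ a → *-congʳ (*-comm _ _))) ⟩
    ΣFin (dim n) (λ b → ΣFin (dim 0) (λ a → counit a * δ n 0 n e a b * g b))
      ≈⟨ ΣFin-cong (dim n) (λ b → trans (sym (*-distribʳ-ΣFin (dim 0) _ _)) (*-congʳ (counitˡ n n e b))) ⟩
    ΣFin (dim n) (λ b → kron dim n n e b * g b)
      ≈⟨ ΣFin-kron dim n e g ⟩
    g e ∎

  counit-⋆ʳ : ∀ n e (g : Fin (dim n) → Carrier) →
              ΣFin (dim n) (λ a → ΣFin (dim 0) (λ b → δ n n 0 e a b * g a * counit b)) ≈ g e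
  counit-⋆ʳ n e g = begin
    ΣFin (dim n) (λ a → ΣFin (dim 0) (λ b → δ n n 0 e a b * g a * counit b))
      ≈⟨ ΣFin-cong (dim n) (λ a → ΣFin-cong (dim 0) (λ b → swap-last (δ n n 0 e a b) (g a) (counit b))) ⟩
    ΣFin (dim n) (λ a → ΣFin (dim 0) (λ b → counit b * δ n n 0 e a b * g a))
      ≈⟨ ΣFin-cong (dim n) (λ a → trans (sym (*-distribʳ-ΣFin (dim 0) _ _)) (*-congʳ (counitʳ n n e a))) ⟩
    ΣFin (dim n) (λ a → kron dim n n e a * g a)
      ≈⟨ ΣFin-kron dim n e g ⟩
    g e ∎
    where
    swap-last : ∀ x y z → x * y * z ≈ z * x * y
    swap-last x y z = trans (*-comm _ _) (sym (*-assoc _ _ _))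

  ⋆-reduceˡ : ∀ (ψ d : Functional) n e → Normalised ψ →
              (∀ i j a b → i ≢ 0 → n ≡ i +ℕ j → ψ i a ≈ 0# ⊎ d j b ≈ 0#) → (ψ ⋆ d) n e ≈ d n e
  ⋆-reduceˡ ψ d n e ψ₀ cross-zero = begin
    (ψ ⋆ d) n e
      ≈⟨ Σ≤-single n 0 _ z≤n (λ i _ i≢0 → Σ≤-zero n (λ j _ → ΣFin-zero (dim i) (λ a → ΣFin-zero (dim j) (λ b →
           δ-term-zero (cross-zero i j a b i≢0))))) ⟩
    Σ≤ n (λ j → ΣFin (dim 0) (λ a → ΣFin (dim j) (λ b → δ n 0 j e a b * ψ 0 a * d j b)))
      ≈⟨ Σ≤-single n n _ ≤-refl (λ j _ j≢n → ΣFin-zero (dim 0) (λ a → ΣFin-zero (dim j) (λ b →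
           δ-off (j≢n ∘ sym-≡) _ _))) ⟩
    ΣFin (dim 0) (λ a → ΣFin (dim n) (λ b → δ n 0 n e a b * ψ 0 a * d n b))
      ≈⟨ ΣFin-cong (dim 0) (λ a → ΣFin-cong (dim n) (λ b → *-congʳ (*-congˡ (ψ₀ a)))) ⟩
    ΣFin (dim 0) (λ a → ΣFin (dim n) (λ b → δ n 0 n e a b * counit a * d n b))
      ≈⟨ counit-⋆ˡ n e (d n) ⟩
    d n e ∎

  ⋆-reduceʳ : ∀ (d ψ : Functional) n e → Normalised ψ →
              (∀ i j a b → j ≢ 0 → n ≡ i +ℕ j → d i a ≈ 0# ⊎ ψ j b ≈ 0#) → (d ⋆ ψ) n e ≈ d n e
  ⋆-reduceʳ d ψ n e ψ₀ cross-zero = begin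
    (d ⋆ ψ) n e
      ≈⟨ Σ≤-comm n n _ ⟩
    Σ≤ n (λ j → Σ≤ n (λ i → ΣFin (dim i) (λ a → ΣFin (dim j) (λ b → δ n i j e a b * d i a * ψ j b))))
      ≈⟨ Σ≤-single n 0 _ z≤n (λ j _ j≢0 → Σ≤-zero n (λ i _ → ΣFin-zero (dim i) (λ a → ΣFin-zero (dim j) (λ b →
           δ-term-zero (cross-zero i j a b j≢0))))) ⟩
    Σ≤ n (λ i → ΣFin (dim i) (λ a → ΣFin (dim 0) (λ b → δ n i 0 e a b * d i a * ψ 0 b)))
      ≈⟨ Σ≤-single n n _ ≤-refl (λ i _ i≢n → ΣFin-zero (dim i) (λ a → ΣFin-zero (dim 0) (λ b →
           δ-off (λ n≡i+0 → i≢n (sym-≡ (trans-≡ n≡i+0 (+-identityʳ-ℕ i)))) _ _))) ⟩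
    ΣFin (dim n) (λ a → ΣFin (dim 0) (λ b → δ n n 0 e a b * d n a * ψ 0 b))
      ≈⟨ ΣFin-cong (dim n) (λ a → ΣFin-cong (dim 0) (λ b → *-congˡ (ψ₀ b))) ⟩
    ΣFin (dim n) (λ a → ΣFin (dim 0) (λ b → δ n n 0 e a b * d n a * counit b))
      ≈⟨ counit-⋆ʳ n e (d n) ⟩
    d n e ∎

  ⋆-identityˡ : ∀ φ → (ε̃ ⋆ φ) ≋ φ
  ⋆-identityˡ φ n e = ⋆-reduceˡ ε̃ φ n e (λ _ → refl) cross-zero
    where
    cross-zero : ∀ i j a b → i ≢ 0 → n ≡ i +ℕ j → ε̃ i a ≈ 0# ⊎ φ j b ≈ 0#
    cross-zero zero    j a b 0≢0 _ = ⊥-elim (0≢0 ≡-refl)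
    cross-zero (suc i) j a b _   _ = inj₁ refl

  ⋆-identityʳ : ∀ φ → (φ ⋆ ε̃) ≋ φ
  ⋆-identityʳ φ n e = ⋆-reduceʳ φ ε̃ n e (λ _ → refl) cross-zero
    where
    cross-zero : ∀ i j a b → j ≢ 0 → n ≡ i +ℕ j → φ i a ≈ 0# ⊎ ε̃ j b ≈ 0#
    cross-zero i zero    a b 0≢0 _ = ⊥-elim (0≢0 ≡-refl)
    cross-zero i (suc j) a b _   _ = inj₂ refl

  ⋆-vanishingˡ : ∀ (ψ d : Functional) n e → Normalised ψ →
                 (∀ m → m < n → ∀ b → d m b ≈ 0#) → (ψ ⋆ d) n e ≈ d n e
  ⋆-vanishingˡ ψ d n e ψ₀ d-low = ⋆-reduceˡ ψ d n e ψ₀ cross-zero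
    where
    cross-zero : ∀ i j a b → i ≢ 0 → n ≡ i +ℕ j → ψ i a ≈ 0# ⊎ d j b ≈ 0#
    cross-zero zero    j a b 0≢0 _      = ⊥-elim (0≢0 ≡-refl)
    cross-zero (suc i) j a b _   ≡-refl = inj₂ (d-low j (s≤s (m≤n+m j i)) b)

  ⋆-vanishingʳ : ∀ (d ψ : Functional) n e → Normalised ψ →
                 (∀ m → m < n → ∀ b → d m b ≈ 0#) → (d ⋆ ψ) n e ≈ d n e
  ⋆-vanishingʳ d ψ n e ψ₀ d-low = ⋆-reduceʳ d ψ n e ψ₀ cross-zero
    where
    cross-zero : ∀ i j a b → j ≢ 0 → n ≡ i +ℕ j → d i a ≈ 0# ⊎ ψ j b ≈ 0#
    cross-zero i zero    a b 0≢0 _      = ⊥-elim (0≢0 ≡-refl)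
    cross-zero i (suc j) a b _   ≡-refl = inj₁ (d-low i (m<m+n i (s≤s z≤n)) a)

  ⋆-expandˡ : ∀ φ ψ χ n e → ((φ ⋆ ψ) ⋆ χ) n e ≈
    Σᴴ n (λ p x → Σᴴ n (λ q y → Σᴴ n (λ r z →
      Σᴴ n (λ m w → δ n m r e w z * δ m p q w x y) * (φ p x * ψ q y * χ r z))))
  ⋆-expandˡ φ ψ χ n e = begin
    ((φ ⋆ ψ) ⋆ χ) n e
      ≈⟨ ⋆-Σᴴ (φ ⋆ ψ) χ e ≤-refl ⟩
    Σᴴ n (λ m w → Σᴴ n (λ r z → δ n m r e w z * (φ ⋆ ψ) m w * χ r z))
      ≈⟨ Σᴴ-cong n (λ m m≤n w → Σᴴ-cong n (λ r _ z → expand m≤n w z)) ⟩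
    Σᴴ n (λ m w → Σᴴ n (λ r z → Σᴴ n (λ p x → Σᴴ n (λ q y → T m w r z p x q y))))
      ≈⟨ Σᴴ-cong n (λ m _ w → trans (Σᴴ-comm n n _) (Σᴴ-cong n (λ p _ x → Σᴴ-comm n n _))) ⟩
    Σᴴ n (λ m w → Σᴴ n (λ p x → Σᴴ n (λ q y → Σᴴ n (λ r z → T m w r z p x q y))))
      ≈⟨ trans (Σᴴ-comm n n _) (Σᴴ-cong n (λ p _ x → trans (Σᴴ-comm n n _) (Σᴴ-cong n (λ q _ y → Σᴴ-comm n n _)))) ⟩
    Σᴴ n (λ p x → Σᴴ n (λ q y → Σᴴ n (λ r z → Σᴴ n (λ m w → T m w r z p x q y))))
      ≈⟨ Σᴴ-cong n (λ p _ x → Σᴴ-cong n (λ q _ y → Σᴴ-cong n (λ r _ z → sym (*-distribʳ-Σᴴ n _ _)))) ⟩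
    Σᴴ n (λ p x → Σᴴ n (λ q y → Σᴴ n (λ r z →
      Σᴴ n (λ m w → δ n m r e w z * δ m p q w x y) * (φ p x * ψ q y * χ r z)))) ∎
    where
    T : (m : ℕ) → Fin (dim m) → (r : ℕ) → Fin (dim r) → (p : ℕ) → Fin (dim p) → (q : ℕ) → Fin (dim q) → Carrier
    T m w r z p x q y = (δ n m r e w z * δ m p q w x y) * (φ p x * ψ q y * χ r z)
    expand : ∀ {m r} → m ≤ n → ∀ w z →
             δ n m r e w z * (φ ⋆ ψ) m w * χ r z ≈ Σᴴ n (λ p x → Σᴴ n (λ q y → T m w r z p x q y))
    expand {m} {r} m≤n w z = begin
      δ n m r e w z * (φ ⋆ ψ) m w * χ r z
        ≈⟨ *-congʳ (*-congˡ (⋆-Σᴴ φ ψ w m≤n)) ⟩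
      δ n m r e w z * Σᴴ n (λ p x → Σᴴ n (λ q y → δ m p q w x y * φ p x * ψ q y)) * χ r z
        ≈⟨ trans (*-congʳ (*-distribˡ-Σᴴ n _ _)) (*-distribʳ-Σᴴ n _ _) ⟩
      Σᴴ n (λ p x → δ n m r e w z * Σᴴ n (λ q y → δ m p q w x y * φ p x * ψ q y) * χ r z)
        ≈⟨ Σᴴ-cong n (λ p _ x → trans (*-congʳ (*-distribˡ-Σᴴ n _ _)) (*-distribʳ-Σᴴ n _ _)) ⟩
      Σᴴ n (λ p x → Σᴴ n (λ q y → δ n m r e w z * (δ m p q w x y * φ p x * ψ q y) * χ r z))
        ≈⟨ Σᴴ-cong n (λ p _ x → Σᴴ-cong n (λ q _ y → regroup _ _ _ _ _)) ⟩
      Σᴴ n (λ p x → Σᴴ n (λ q y → T m w r z p x q y)) ∎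
      where
      regroup : ∀ D d u v t → D * (d * u * v) * t ≈ (D * d) * (u * v * t)
      regroup = solve 5 (λ D d u v t → (D · ((d · u) · v)) · t ⊜ (D · d) · ((u · v) · t)) refl

  ⋆-expandʳ : ∀ φ ψ χ n e → (φ ⋆ (ψ ⋆ χ)) n e ≈
    Σᴴ n (λ p x → Σᴴ n (λ q y → Σᴴ n (λ r z →
      Σᴴ n (λ m w → δ n p m e x w * δ m q r w y z) * (φ p x * ψ q y * χ r z))))
  ⋆-expandʳ φ ψ χ n e = begin
    (φ ⋆ (ψ ⋆ χ)) n e
      ≈⟨ ⋆-Σᴴ φ (ψ ⋆ χ) e ≤-refl ⟩
    Σᴴ n (λ p x → Σᴴ n (λ m w → δ n p m e x w * φ p x * (ψ ⋆ χ) m w))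
      ≈⟨ Σᴴ-cong n (λ p _ x → Σᴴ-cong n (λ m m≤n w → expand x m≤n w)) ⟩
    Σᴴ n (λ p x → Σᴴ n (λ m w → Σᴴ n (λ q y → Σᴴ n (λ r z → T p x m w q y r z))))
      ≈⟨ Σᴴ-cong n (λ p _ x → trans (Σᴴ-comm n n _) (Σᴴ-cong n (λ q _ y → Σᴴ-comm n n _))) ⟩
    Σᴴ n (λ p x → Σᴴ n (λ q y → Σᴴ n (λ r z → Σᴴ n (λ m w → T p x m w q y r z))))
      ≈⟨ Σᴴ-cong n (λ p _ x → Σᴴ-cong n (λ q _ y → Σᴴ-cong n (λ r _ z → sym (*-distribʳ-Σᴴ n _ _)))) ⟩
    Σᴴ n (λ p x → Σᴴ n (λ q y → Σᴴ n (λ r z →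
      Σᴴ n (λ m w → δ n p m e x w * δ m q r w y z) * (φ p x * ψ q y * χ r z)))) ∎
    where
    T : (p : ℕ) → Fin (dim p) → (m : ℕ) → Fin (dim m) → (q : ℕ) → Fin (dim q) → (r : ℕ) → Fin (dim r) → Carrier
    T p x m w q y r z = (δ n p m e x w * δ m q r w y z) * (φ p x * ψ q y * χ r z)
    expand : ∀ {p m} x → m ≤ n → ∀ w →
             δ n p m e x w * φ p x * (ψ ⋆ χ) m w ≈ Σᴴ n (λ q y → Σᴴ n (λ r z → T p x m w q y r z))
    expand {p} {m} x m≤n w = begin
      δ n p m e x w * φ p x * (ψ ⋆ χ) m w
        ≈⟨ *-congˡ (⋆-Σᴴ ψ χ w m≤n) ⟩
      δ n p m e x w * φ p x * Σᴴ n (λ q y → Σᴴ n (λ r z → δ m q r w y z * ψ q y * χ r z))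
        ≈⟨ *-distribˡ-Σᴴ n _ _ ⟩
      Σᴴ n (λ q y → δ n p m e x w * φ p x * Σᴴ n (λ r z → δ m q r w y z * ψ q y * χ r z))
        ≈⟨ Σᴴ-cong n (λ q _ y → trans (*-distribˡ-Σᴴ n _ _) (Σᴴ-cong n (λ r _ z → regroup _ _ _ _ _))) ⟩
      Σᴴ n (λ q y → Σᴴ n (λ r z → T p x m w q y r z)) ∎
      where
      regroup : ∀ D u d v t → D * u * (d * v * t) ≈ (D * d) * (u * v * t)
      regroup = solve 5 (λ D u d v t → (D · u) · ((d · v) · t) ⊜ (D · d) · ((u · v) · t)) refl

  ⋆-assoc : ∀ φ ψ χ → ((φ ⋆ ψ) ⋆ χ) ≋ (φ ⋆ (ψ ⋆ χ))
  ⋆-assoc φ ψ χ n e = begin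
    ((φ ⋆ ψ) ⋆ χ) n e
      ≈⟨ ⋆-expandˡ φ ψ χ n e ⟩
    Σᴴ n (λ p x → Σᴴ n (λ q y → Σᴴ n (λ r z →
      Σᴴ n (λ m w → δ n m r e w z * δ m p q w x y) * (φ p x * ψ q y * χ r z))))
      ≈⟨ Σᴴ-cong n (λ p _ x → Σᴴ-cong n (λ q _ y → Σᴴ-cong n (λ r _ z → *-congʳ (coassoc n p q r e x y z)))) ⟩
    Σᴴ n (λ p x → Σᴴ n (λ q y → Σᴴ n (λ r z →
      Σᴴ n (λ m w → δ n p m e x w * δ m q r w y z) * (φ p x * ψ q y * χ r z))))
      ≈⟨ ⋆-expandʳ φ ψ χ n e ⟨
    (φ ⋆ (ψ ⋆ χ)) n e ∎

  ⋆-cong-≤ : ∀ {φ φ′ ψ ψ′} n → (∀ m → m ≤ n → ∀ a → φ m a ≈ φ′ m a) →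
             (∀ m → m ≤ n → ∀ a → ψ m a ≈ ψ′ m a) → ∀ e → (φ ⋆ ψ) n e ≈ (φ′ ⋆ ψ′) n e
  ⋆-cong-≤ n φ≈φ′ ψ≈ψ′ e = Σ⋆-cong n (λ i j i≤n j≤n a b → *-cong (*-congˡ (φ≈φ′ i i≤n a)) (ψ≈ψ′ j j≤n b))

  ⋆-cong : ∀ {φ φ′ ψ ψ′} → φ ≋ φ′ → ψ ≋ ψ′ → (φ ⋆ ψ) ≋ (φ′ ⋆ ψ′)
  ⋆-cong φ≋φ′ ψ≋ψ′ n = ⋆-cong-≤ n (λ m _ → φ≋φ′ m) (λ m _ → ψ≋ψ′ m)

  _⊕_ : Functional → Functional → Functional
  (φ ⊕ ψ) n a = φ n a + ψ n a

  ⋆-distribˡ-⊕ : ∀ φ ψ χ → (φ ⋆ (ψ ⊕ χ)) ≋ ((φ ⋆ ψ) ⊕ (φ ⋆ χ))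
  ⋆-distribˡ-⊕ φ ψ χ n e = begin
    (φ ⋆ (ψ ⊕ χ)) n e
      ≈⟨ ⋆-Σᴴ φ (ψ ⊕ χ) e ≤-refl ⟩
    Σᴴ n (λ i a → Σᴴ n (λ j b → δ n i j e a b * φ i a * (ψ j b + χ j b)))
      ≈⟨ Σᴴ²-distrib-+ n (λ i a j b → distribˡ (δ n i j e a b * φ i a) (ψ j b) (χ j b)) ⟩
    Σᴴ n (λ i a → Σᴴ n (λ j b → δ n i j e a b * φ i a * ψ j b)) +
    Σᴴ n (λ i a → Σᴴ n (λ j b → δ n i j e a b * φ i a * χ j b))
      ≈⟨ +-cong (⋆-Σᴴ φ ψ e ≤-refl) (⋆-Σᴴ φ χ e ≤-refl) ⟨
    (φ ⋆ ψ) n e + (φ ⋆ χ) n e ∎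

  ⋆-distribʳ-⊕ : ∀ φ ψ χ → ((ψ ⊕ χ) ⋆ φ) ≋ ((ψ ⋆ φ) ⊕ (χ ⋆ φ))
  ⋆-distribʳ-⊕ φ ψ χ n e = begin
    ((ψ ⊕ χ) ⋆ φ) n e
      ≈⟨ ⋆-Σᴴ (ψ ⊕ χ) φ e ≤-refl ⟩
    Σᴴ n (λ i a → Σᴴ n (λ j b → δ n i j e a b * (ψ i a + χ i a) * φ j b))
      ≈⟨ Σᴴ²-distrib-+ n (λ i a j b → trans (*-congʳ (distribˡ (δ n i j e a b) (ψ i a) (χ i a))) (distribʳ (φ j b) _ _)) ⟩
    Σᴴ n (λ i a → Σᴴ n (λ j b → δ n i j e a b * ψ i a * φ j b)) +
    Σᴴ n (λ i a → Σᴴ n (λ j b → δ n i j e a b * χ i a * φ j b))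
      ≈⟨ +-cong (⋆-Σᴴ ψ φ e ≤-refl) (⋆-Σᴴ χ φ e ≤-refl) ⟨
    (ψ ⋆ φ) n e + (χ ⋆ φ) n e ∎

  ⋆-square-top : ∀ α β n e → Normalised α → Normalised β → (∀ m → m < n → ∀ b → α m b ≈ β m b) →
                 (α ⋆ α) n e ≈ (β ⋆ β) n e + ((α n e - β n e) + (α n e - β n e))
  ⋆-square-top α β n e α₀ β₀ α≈β-below = begin
    (α ⋆ α) n e                          ≈⟨ ⋆-cong (λ _ _ → refl) α≋β⊕d n e ⟩
    (α ⋆ (β ⊕ d)) n e                    ≈⟨ ⋆-distribˡ-⊕ α β d n e ⟩
    (α ⋆ β) n e + (α ⋆ d) n e            ≈⟨ +-congʳ (⋆-cong α≋β⊕d (λ _ _ → refl) n e) ⟩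
    ((β ⊕ d) ⋆ β) n e + (α ⋆ d) n e      ≈⟨ +-cong (⋆-distribʳ-⊕ β β d n e) (⋆-vanishingˡ α d n e α₀ d-below) ⟩
    ((β ⋆ β) n e + (d ⋆ β) n e) + d n e  ≈⟨ +-congʳ (+-congˡ (⋆-vanishingʳ d β n e β₀ d-below)) ⟩
    ((β ⋆ β) n e + d n e) + d n e        ≈⟨ +-assoc _ _ _ ⟩
    (β ⋆ β) n e + (d n e + d n e)        ∎
    where
    d : Functional
    d m b = α m b - β m b
    α≋β⊕d : α ≋ (β ⊕ d)
    α≋β⊕d m b = sym (y+[x-y]≈x (α m b) (β m b))
    d-below : ∀ m → m < n → ∀ b → d m b ≈ 0#
    d-below m m<n b = x≈y⇒x∙y⁻¹≈ε (α≈β-below m m<n b)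

  bar-bar : ∀ φ → bar (bar φ) ≋ φ
  bar-bar φ n a = trans (sym (*-assoc _ _ _)) (trans (*-congʳ (sgn-sgn n)) (*-identityˡ _))

  bar-cong : ∀ {φ ψ} → φ ≋ ψ → bar φ ≋ bar ψ
  bar-cong φ≋ψ n a = *-congˡ (φ≋ψ n a)

  bar-ε̃ : bar ε̃ ≋ ε̃
  bar-ε̃ zero    a = *-identityˡ _
  bar-ε̃ (suc n) a = zeroʳ _

  bar-⋆ : ∀ φ ψ → bar (φ ⋆ ψ) ≋ (bar φ ⋆ bar ψ)
  bar-⋆ φ ψ n e = begin
    sgn n * (φ ⋆ ψ) n e
      ≈⟨ *-congˡ (⋆-Σᴴ φ ψ e ≤-refl) ⟩
    sgn n * Σᴴ n (λ i a → Σᴴ n (λ j b → δ n i j e a b * φ i a * ψ j b))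
      ≈⟨ trans (*-distribˡ-Σᴴ n _ _) (Σᴴ-cong n (λ i _ a → trans (*-distribˡ-Σᴴ n _ _) (Σᴴ-cong n (λ j _ b → signs i j a b)))) ⟩
    Σᴴ n (λ i a → Σᴴ n (λ j b → δ n i j e a b * bar φ i a * bar ψ j b))
      ≈⟨ ⋆-Σᴴ (bar φ) (bar ψ) e ≤-refl ⟨
    (bar φ ⋆ bar ψ) n e ∎
    where
    signs : ∀ i j a b → sgn n * (δ n i j e a b * φ i a * ψ j b) ≈ δ n i j e a b * bar φ i a * bar ψ j b
    signs i j a b with n ≟ i +ℕ j
    ... | no n≢i+j = trans (*-congˡ (δ-off n≢i+j _ _)) (trans (zeroʳ _) (sym (δ-off n≢i+j _ _)))
    ... | yes ≡-refl = trans (*-congʳ (sgn-+ i j)) (regroup _ _ _ _ _)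
      where
      regroup : ∀ s t D x y → (s * t) * (D * x * y) ≈ D * (s * x) * (t * y)
      regroup = solve 5 (λ s t D x y → (s · t) · ((D · x) · y) ⊜ (D · (s · x)) · (t · y)) refl

  ⁻¹-cong : ∀ {φ ψ} → φ ≋ ψ → (φ ⁻¹) ≋ (ψ ⁻¹)
  ⁻¹-cong φ≋ψ n e = ΣFin-cong (dim n) (λ a → *-congˡ (φ≋ψ n a))

  bar-⁻¹ : ∀ φ → bar (φ ⁻¹) ≋ (bar φ ⁻¹)
  bar-⁻¹ φ n e = trans (*-distribˡ-ΣFin (dim n) _ _) (ΣFin-cong (dim n) (λ a → x∙yz≈y∙xz _ _ _))

module CharacterTheory {c ℓ} {F : Field c ℓ} (H : GCHopf F) where
  open Field F hiding (zero)
  open Sums F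
  open SumsProperties F
  open GCHopf H
  open Characters H
  open Convolution H
  open import Algebra.Solver.CommutativeMonoid *-commutativeMonoid using (solve; _⊜_) renaming (_⊕_ to _·_)
  open import Algebra.Properties.Group +-group using (x≈y⇒x∙y⁻¹≈ε; x∙y⁻¹≈ε⇒x≈y)
  open import Algebra.Properties.AbelianGroup +-abelianGroup using (xyx⁻¹≈y)
  open import Algebra.Properties.CommutativeSemigroup *-commutativeSemigroup using (x∙yz≈y∙xz) renaming (interchange to *-interchange)
  open import Relation.Binary.Reasoning.Setoid setoid

  𝟙 : Fin (dim 0)
  𝟙 = subst Fin (sym-≡ connected) Fin.zero

  ΣH₀ : ∀ (f : Fin (dim 0) → Carrier) → ΣFin (dim 0) f ≈ f 𝟙
  ΣH₀ = ΣFin-singleton connected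

  H₀-unique : ∀ (a : Fin (dim 0)) → a ≡ 𝟙
  H₀-unique = go connected
    where
    go : ∀ {m} (m≡1 : m ≡ 1) (a : Fin m) → a ≡ subst Fin (sym-≡ m≡1) Fin.zero
    go ≡-refl Fin.zero = ≡-refl

  character⇒normalised : ∀ {φ} → IsCharacter φ → Normalised φ
  character⇒normalised {φ} (_ , φ-unit) a rewrite H₀-unique a = begin
    φ 0 𝟙                         ≈⟨ *-identityˡ _ ⟨
    1# * φ 0 𝟙                    ≈⟨ *-congʳ (trans (sym (ΣH₀ _)) counit-unit) ⟨
    unit 𝟙 * counit 𝟙 * φ 0 𝟙     ≈⟨ solve 3 (λ u c f → (u · c) · f ⊜ c · (u · f)) refl _ _ _ ⟩
    counit 𝟙 * (unit 𝟙 * φ 0 𝟙)   ≈⟨ *-congˡ (trans (sym (ΣH₀ _)) φ-unit) ⟩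
    counit 𝟙 * 1#                 ≈⟨ *-identityʳ _ ⟩
    counit 𝟙                      ∎

  -- functionals on H ⊗ H, given on the basis vectors e^p_x ⊗ e^q_y
  Functional² : Set c
  Functional² = (p q : ℕ) → Fin (dim p) → Fin (dim q) → Carrier

  _∘μ : Functional → Functional²
  (φ ∘μ) i j a b = Σᴴ (i +ℕ j) (λ m z → μ i j m a b z * φ m z)

  _⊗_ : Functional → Functional → Functional²
  (φ ⊗ ψ) i j a b = φ i a * ψ j b

  Multiplicative : Functional → Set ℓ
  Multiplicative φ = ∀ i j a b → (φ ∘μ) i j a b ≈ (φ ⊗ φ) i j a b

  normalised-multiplicative⇒character : ∀ {φ} → Normalised φ → Multiplicative φ → IsCharacter φ
  normalised-multiplicative⇒character φ₀ φ-mult =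
    φ-mult , trans (ΣFin-cong (dim 0) (λ a → *-congˡ (φ₀ a))) counit-unit

  ε̃-character : IsCharacter ε̃
  ε̃-character = normalised-multiplicative⇒character (λ _ → refl) ε̃-mult
    where
    ε̃-mult : Multiplicative ε̃
    ε̃-mult i j a b = trans (Σ≤-single (i +ℕ j) 0 _ z≤n positive-degree-zero) (counit-mult i j a b)
      where
      positive-degree-zero : ∀ m → m ≤ i +ℕ j → m ≢ 0 → ΣFin (dim m) (λ z → μ i j m a b z * ε̃ m z) ≈ 0#
      positive-degree-zero zero    _ 0≢0 = ⊥-elim (0≢0 ≡-refl)
      positive-degree-zero (suc m) _ _   = ΣFin-zero (dim (suc m)) (λ z → zeroʳ _)

  antipode-contract : ∀ {φ} → IsCharacter φ → ∀ n e
    (X : (i j : ℕ) → Fin (dim i) → Fin (dim j) → (p : ℕ) → Fin (dim p) → Carrier) →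
    (∀ p f → Σ⋆ n (λ i j a b → X i j a b p f) ≈ ε̃ n e * 1̃ p f) →
    Σ⋆ n (λ i j a b → Σᴴ n (λ p f → X i j a b p f * φ p f)) ≈ ε̃ n e
  antipode-contract {φ} (_ , φ-unit) n e X antipode = begin
    Σ⋆ n (λ i j a b → Σᴴ n (λ p f → X i j a b p f * φ p f))
      ≈⟨ Σ⋆-Σᴴ-comm n n _ ⟩
    Σᴴ n (λ p f → Σ⋆ n (λ i j a b → X i j a b p f * φ p f))
      ≈⟨ Σᴴ-cong n (λ p _ f → trans (sym (*-distribʳ-Σ⋆ n _ _)) (trans (*-congʳ (antipode p f)) (*-assoc _ _ _))) ⟩
    Σᴴ n (λ p f → ε̃ n e * (1̃ p f * φ p f))
      ≈⟨ *-distribˡ-Σᴴ n _ _ ⟨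
    ε̃ n e * Σᴴ n (λ p f → 1̃ p f * φ p f)
      ≈⟨ *-congˡ (Σ≤-single n 0 _ z≤n positive-degree-zero) ⟩
    ε̃ n e * ΣFin (dim 0) (λ f → unit f * φ 0 f)
      ≈⟨ *-congˡ φ-unit ⟩
    ε̃ n e * 1#
      ≈⟨ *-identityʳ _ ⟩
    ε̃ n e ∎
    where
    positive-degree-zero : ∀ p → p ≤ n → p ≢ 0 → ΣFin (dim p) (λ f → 1̃ p f * φ p f) ≈ 0#
    positive-degree-zero zero    _ 0≢0 = ⊥-elim (0≢0 ≡-refl)
    positive-degree-zero (suc p) _ _   = ΣFin-zero (dim (suc p)) (λ f → zeroˡ _)

  ⁻¹-inverseˡ : ∀ {φ} → IsCharacter φ → ((φ ⁻¹) ⋆ φ) ≋ ε̃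
  ⁻¹-inverseˡ {φ} χ@(φ-mult , _) n e =
    trans (Σ⋆-cong n (λ i j _ _ → expand i j)) (antipode-contract χ n e _ (λ p f → antipodeˡ n p e f))
    where
    expand : ∀ i j a b → δ n i j e a b * (φ ⁻¹) i a * φ j b ≈
             Σᴴ n (λ p f → ΣFin (dim i) (λ a′ → δ n i j e a b * S i a a′ * μ i j p a′ b f) * φ p f)
    expand i j a b with n ≟ i +ℕ j
    ... | no n≢i+j = trans (δ-off n≢i+j _ _)
                       (sym (Σᴴ-zero n (λ p _ f → trans (*-congʳ (ΣFin-zero (dim i) (λ a′ → δ-off n≢i+j _ _))) (zeroˡ _))))
    ... | yes ≡-refl = begin
      δ n i j e a b * ΣFin (dim i) (λ a′ → S i a a′ * φ i a′) * φ j b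
        ≈⟨ trans (*-congʳ (*-distribˡ-ΣFin (dim i) _ _)) (*-distribʳ-ΣFin (dim i) _ _) ⟩
      ΣFin (dim i) (λ a′ → δ n i j e a b * (S i a a′ * φ i a′) * φ j b)
        ≈⟨ ΣFin-cong (dim i) (λ a′ → regroup _ _ _ _) ⟩
      ΣFin (dim i) (λ a′ → δ n i j e a b * S i a a′ * (φ i a′ * φ j b))
        ≈⟨ ΣFin-cong (dim i) (λ a′ → trans (*-congˡ (sym (φ-mult i j a′ b))) (*-distribˡ-Σᴴ n _ _)) ⟩
      ΣFin (dim i) (λ a′ → Σᴴ n (λ p f → δ n i j e a b * S i a a′ * (μ i j p a′ b f * φ p f)))
        ≈⟨ ΣFin-Σᴴ-comm (dim i) n _ ⟩
      Σᴴ n (λ p f → ΣFin (dim i) (λ a′ → δ n i j e a b * S i a a′ * (μ i j p a′ b f * φ p f)))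
        ≈⟨ Σᴴ-cong n (λ p _ f → trans (ΣFin-cong (dim i) (λ a′ → sym (*-assoc _ _ _))) (sym (*-distribʳ-ΣFin (dim i) _ _))) ⟩
      Σᴴ n (λ p f → ΣFin (dim i) (λ a′ → δ n i j e a b * S i a a′ * μ i j p a′ b f) * φ p f) ∎
      where
      regroup : ∀ d s x y → d * (s * x) * y ≈ d * s * (x * y)
      regroup = solve 4 (λ d s x y → (d · (s · x)) · y ⊜ (d · s) · (x · y)) refl

  ⁻¹-inverseʳ : ∀ {φ} → IsCharacter φ → (φ ⋆ (φ ⁻¹)) ≋ ε̃
  ⁻¹-inverseʳ {φ} χ@(φ-mult , _) n e =
    trans (Σ⋆-cong n (λ i j _ _ → expand i j)) (antipode-contract χ n e _ (λ p f → antipodeʳ n p e f))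
    where
    expand : ∀ i j a b → δ n i j e a b * φ i a * (φ ⁻¹) j b ≈
             Σᴴ n (λ p f → ΣFin (dim j) (λ b′ → δ n i j e a b * S j b b′ * μ i j p a b′ f) * φ p f)
    expand i j a b with n ≟ i +ℕ j
    ... | no n≢i+j = trans (δ-off n≢i+j _ _)
                       (sym (Σᴴ-zero n (λ p _ f → trans (*-congʳ (ΣFin-zero (dim j) (λ b′ → δ-off n≢i+j _ _))) (zeroˡ _))))
    ... | yes ≡-refl = begin
      δ n i j e a b * φ i a * ΣFin (dim j) (λ b′ → S j b b′ * φ j b′)
        ≈⟨ *-distribˡ-ΣFin (dim j) _ _ ⟩
      ΣFin (dim j) (λ b′ → δ n i j e a b * φ i a * (S j b b′ * φ j b′))
        ≈⟨ ΣFin-cong (dim j) (λ b′ → regroup _ _ _ _) ⟩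
      ΣFin (dim j) (λ b′ → δ n i j e a b * S j b b′ * (φ i a * φ j b′))
        ≈⟨ ΣFin-cong (dim j) (λ b′ → trans (*-congˡ (sym (φ-mult i j a b′))) (*-distribˡ-Σᴴ n _ _)) ⟩
      ΣFin (dim j) (λ b′ → Σᴴ n (λ p f → δ n i j e a b * S j b b′ * (μ i j p a b′ f * φ p f)))
        ≈⟨ ΣFin-Σᴴ-comm (dim j) n _ ⟩
      Σᴴ n (λ p f → ΣFin (dim j) (λ b′ → δ n i j e a b * S j b b′ * (μ i j p a b′ f * φ p f)))
        ≈⟨ Σᴴ-cong n (λ p _ f → trans (ΣFin-cong (dim j) (λ b′ → sym (*-assoc _ _ _))) (sym (*-distribʳ-ΣFin (dim j) _ _))) ⟩
      Σᴴ n (λ p f → ΣFin (dim j) (λ b′ → δ n i j e a b * S j b b′ * μ i j p a b′ f) * φ p f) ∎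
      where
      regroup : ∀ d x s y → d * x * (s * y) ≈ d * s * (x * y)
      regroup = solve 4 (λ d x s y → (d · x) · (s · y) ⊜ (d · s) · (x · y)) refl

  Functional⁴ : Set c
  Functional⁴ = (p₁ : ℕ) → Fin (dim p₁) → (q₁ : ℕ) → Fin (dim q₁) → (p₂ : ℕ) → Fin (dim p₂) → (q₂ : ℕ) → Fin (dim q₂) → Carrier

  ΣΔΔ : ℕ → ℕ → Functional⁴ → Carrier
  ΣΔΔ i j G = Σᴴ i (λ p₁ x₁ → Σᴴ i (λ q₁ y₁ → Σᴴ j (λ p₂ x₂ → Σᴴ j (λ q₂ y₂ → G p₁ x₁ q₁ y₁ p₂ x₂ q₂ y₂))))

  ΣΔΔ-cong : ∀ i j {G G′ : Functional⁴} →
             (∀ p₁ x₁ q₁ y₁ p₂ x₂ q₂ y₂ → p₁ ≤ i → q₁ ≤ i → p₂ ≤ j → q₂ ≤ j →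
               G p₁ x₁ q₁ y₁ p₂ x₂ q₂ y₂ ≈ G′ p₁ x₁ q₁ y₁ p₂ x₂ q₂ y₂) → ΣΔΔ i j G ≈ ΣΔΔ i j G′
  ΣΔΔ-cong i j G≈G′ = Σᴴ-cong i (λ p₁ p₁≤i x₁ → Σᴴ-cong i (λ q₁ q₁≤i y₁ → Σᴴ-cong j (λ p₂ p₂≤j x₂ → Σᴴ-cong j (λ q₂ q₂≤j y₂ →
                        G≈G′ p₁ x₁ q₁ y₁ p₂ x₂ q₂ y₂ p₁≤i q₁≤i p₂≤j q₂≤j))))

  ΣΔΔ-distrib-+ : ∀ i j (G G′ : Functional⁴) →
                  ΣΔΔ i j (λ p₁ x₁ q₁ y₁ p₂ x₂ q₂ y₂ → G p₁ x₁ q₁ y₁ p₂ x₂ q₂ y₂ + G′ p₁ x₁ q₁ y₁ p₂ x₂ q₂ y₂)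
                    ≈ ΣΔΔ i j G + ΣΔΔ i j G′
  ΣΔΔ-distrib-+ i j G G′ = trans (Σᴴ-cong i (λ p₁ _ x₁ → trans (Σᴴ-cong i (λ q₁ _ y₁ → trans (Σᴴ-cong j (λ p₂ _ x₂ →
                             Σᴴ-distrib-+ j _ _)) (Σᴴ-distrib-+ j _ _))) (Σᴴ-distrib-+ i _ _))) (Σᴴ-distrib-+ i _ _)

  *-distribʳ-ΣΔΔ : ∀ i j (G : Functional⁴) x →
                   ΣΔΔ i j G * x ≈ ΣΔΔ i j (λ p₁ x₁ q₁ y₁ p₂ x₂ q₂ y₂ → G p₁ x₁ q₁ y₁ p₂ x₂ q₂ y₂ * x)
  *-distribʳ-ΣΔΔ i j G x = trans (*-distribʳ-Σᴴ i _ _) (Σᴴ-cong i (λ p₁ _ x₁ → trans (*-distribʳ-Σᴴ i _ _) (Σᴴ-cong i (λ q₁ _ y₁ →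
                             trans (*-distribʳ-Σᴴ j _ _) (Σᴴ-cong j (λ p₂ _ x₂ → *-distribʳ-Σᴴ j _ _))))))

  Σᴴ-ΣΔΔ-comm : ∀ N i j (G : (p : ℕ) → Fin (dim p) → Functional⁴) →
                Σᴴ N (λ p x → ΣΔΔ i j (G p x)) ≈
                ΣΔΔ i j (λ p₁ x₁ q₁ y₁ p₂ x₂ q₂ y₂ → Σᴴ N (λ p x → G p x p₁ x₁ q₁ y₁ p₂ x₂ q₂ y₂))
  Σᴴ-ΣΔΔ-comm N i j G = trans (Σᴴ-comm N i _) (Σᴴ-cong i (λ p₁ _ x₁ → trans (Σᴴ-comm N i _) (Σᴴ-cong i (λ q₁ _ y₁ →
                          trans (Σᴴ-comm N j _) (Σᴴ-cong j (λ p₂ _ x₂ → Σᴴ-comm N j _))))))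

  -- convolution on H ⊗ H, whose coproduct is Δ ⊗ Δ followed by swapping the two middle factors
  _⋆²_ : Functional² → Functional² → Functional²
  (A ⋆² B) i j a b =
    ΣΔΔ i j (λ p₁ x₁ q₁ y₁ p₂ x₂ q₂ y₂ → δ i p₁ q₁ a x₁ y₁ * δ j p₂ q₂ b x₂ y₂ * (A p₁ p₂ x₁ x₂ * B q₁ q₂ y₁ y₂))

  μ-δ-compatible : ∀ i j p q (a : Fin (dim i)) (b : Fin (dim j)) (x : Fin (dim p)) (y : Fin (dim q)) →
    Σᴴ (i +ℕ j) (λ m z → μ i j m a b z * δ m p q z x y) ≈
    ΣΔΔ i j (λ p₁ x₁ q₁ y₁ p₂ x₂ q₂ y₂ → δ i p₁ q₁ a x₁ y₁ * δ j p₂ q₂ b x₂ y₂ * (μ p₁ p₂ p x₁ x₂ x * μ q₁ q₂ q y₁ y₂ y))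
  μ-δ-compatible i j p q a b x y = trans (δ-mult i j p q a b x y) (Σ≤-cong i (λ p₁ _ →
    trans (Σ≤-cong i (λ q₁ _ → trans (Σ≤-cong j (λ p₂ _ → Σ≤-ΣFin-comm j (dim p₁) _)) (Σ≤-ΣFin-comm j (dim p₁) _)))
    (trans (Σ≤-ΣFin-comm i (dim p₁) _) (ΣFin-cong (dim p₁) (λ x₁ → Σ≤-cong i (λ q₁ _ →
      trans (Σ≤-cong j (λ p₂ _ → Σ≤-ΣFin-comm j (dim q₁) _)) (trans (Σ≤-ΣFin-comm j (dim q₁) _)
      (ΣFin-cong (dim q₁) (λ y₁ → Σ≤-cong j (λ p₂ _ → Σ≤-ΣFin-comm j (dim p₂) _))))))))))

  ∘μ-extend : ∀ τ {N p₁ p₂} x₁ x₂ → p₁ +ℕ p₂ ≤ N →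
              Σᴴ N (λ p x → μ p₁ p₂ p x₁ x₂ x * τ p x) ≈ (τ ∘μ) p₁ p₂ x₁ x₂
  ∘μ-extend τ {p₁ = p₁} {p₂} x₁ x₂ p₁+p₂≤N =
    sym (Σᴴ-extend (p₁ +ℕ p₂) _ _ p₁+p₂≤N
          (λ p p₁+p₂<p _ x → trans (*-congʳ (μ-graded p₁ p₂ p x₁ x₂ x (λ p≡ → <-irrefl (sym-≡ p≡) p₁+p₂<p))) (zeroˡ _)))

  Σᴴ²-∘μ-⊗ : ∀ σ ω {N p₁ p₂ q₁ q₂} D x₁ x₂ y₁ y₂ → p₁ +ℕ p₂ ≤ N → q₁ +ℕ q₂ ≤ N →
    Σᴴ N (λ p x → Σᴴ N (λ q y → D * (μ p₁ p₂ p x₁ x₂ x * μ q₁ q₂ q y₁ y₂ y) * (σ p x * ω q y)))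
      ≈ D * ((σ ∘μ) p₁ p₂ x₁ x₂ * (ω ∘μ) q₁ q₂ y₁ y₂)
  Σᴴ²-∘μ-⊗ σ ω {N} {p₁} {p₂} {q₁} {q₂} D x₁ x₂ y₁ y₂ p₁+p₂≤N q₁+q₂≤N = begin
    Σᴴ N (λ p x → Σᴴ N (λ q y → D * (μ p₁ p₂ p x₁ x₂ x * μ q₁ q₂ q y₁ y₂ y) * (σ p x * ω q y)))
      ≈⟨ Σᴴ-cong N (λ p _ x → Σᴴ-cong N (λ q _ y → regroup _ _ _ _ _)) ⟩
    Σᴴ N (λ p x → Σᴴ N (λ q y → D * ((μ p₁ p₂ p x₁ x₂ x * σ p x) * (μ q₁ q₂ q y₁ y₂ y * ω q y))))
      ≈⟨ trans (Σᴴ-cong N (λ p _ x → sym (*-distribˡ-Σᴴ N _ _))) (sym (*-distribˡ-Σᴴ N _ _)) ⟩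
    D * Σᴴ N (λ p x → Σᴴ N (λ q y → (μ p₁ p₂ p x₁ x₂ x * σ p x) * (μ q₁ q₂ q y₁ y₂ y * ω q y)))
      ≈⟨ *-congˡ (trans (Σᴴ-cong N (λ p _ x → sym (*-distribˡ-Σᴴ N _ _))) (sym (*-distribʳ-Σᴴ N _ _))) ⟩
    D * (Σᴴ N (λ p x → μ p₁ p₂ p x₁ x₂ x * σ p x) * Σᴴ N (λ q y → μ q₁ q₂ q y₁ y₂ y * ω q y))
      ≈⟨ *-congˡ (*-cong (∘μ-extend σ x₁ x₂ p₁+p₂≤N) (∘μ-extend ω y₁ y₂ q₁+q₂≤N)) ⟩
    D * ((σ ∘μ) p₁ p₂ x₁ x₂ * (ω ∘μ) q₁ q₂ y₁ y₂) ∎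
    where
    regroup : ∀ d u v s w → d * (u * v) * (s * w) ≈ d * ((u * s) * (v * w))
    regroup = solve 5 (λ d u v s w → (d · (u · v)) · (s · w) ⊜ d · ((u · s) · (v · w))) refl

  ∘μ-⋆ : ∀ σ ω i j a b → ((σ ⋆ ω) ∘μ) i j a b ≈ ((σ ∘μ) ⋆² (ω ∘μ)) i j a b
  ∘μ-⋆ σ ω i j a b = begin
    Σᴴ N (λ m z → μ i j m a b z * (σ ⋆ ω) m z)
      ≈⟨ Σᴴ-cong N (λ m m≤N z → trans (*-congˡ (⋆-Σᴴ σ ω z m≤N)) (trans (*-distribˡ-Σᴴ N _ _)
           (Σᴴ-cong N (λ p _ x → trans (*-distribˡ-Σᴴ N _ _) (Σᴴ-cong N (λ q _ y → regroup _ _ _ _)))))) ⟩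
    Σᴴ N (λ m z → Σᴴ N (λ p x → Σᴴ N (λ q y → μ i j m a b z * δ m p q z x y * (σ p x * ω q y))))
      ≈⟨ trans (Σᴴ-comm N N _) (Σᴴ-cong N (λ p _ x → trans (Σᴴ-comm N N _)
           (Σᴴ-cong N (λ q _ y → sym (*-distribʳ-Σᴴ N _ _))))) ⟩
    Σᴴ N (λ p x → Σᴴ N (λ q y → Σᴴ N (λ m z → μ i j m a b z * δ m p q z x y) * (σ p x * ω q y)))
      ≈⟨ Σᴴ-cong N (λ p _ x → Σᴴ-cong N (λ q _ y → trans (*-congʳ (μ-δ-compatible i j p q a b x y)) (*-distribʳ-ΣΔΔ i j _ _))) ⟩
    Σᴴ N (λ p x → Σᴴ N (λ q y → ΣΔΔ i j (λ p₁ x₁ q₁ y₁ p₂ x₂ q₂ y₂ →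
      δ i p₁ q₁ a x₁ y₁ * δ j p₂ q₂ b x₂ y₂ * (μ p₁ p₂ p x₁ x₂ x * μ q₁ q₂ q y₁ y₂ y) * (σ p x * ω q y))))
      ≈⟨ trans (Σᴴ-cong N (λ p _ x → Σᴴ-ΣΔΔ-comm N i j _)) (Σᴴ-ΣΔΔ-comm N i j _) ⟩
    ΣΔΔ i j (λ p₁ x₁ q₁ y₁ p₂ x₂ q₂ y₂ → Σᴴ N (λ p x → Σᴴ N (λ q y →
      δ i p₁ q₁ a x₁ y₁ * δ j p₂ q₂ b x₂ y₂ * (μ p₁ p₂ p x₁ x₂ x * μ q₁ q₂ q y₁ y₂ y) * (σ p x * ω q y))))
      ≈⟨ ΣΔΔ-cong i j (λ p₁ x₁ q₁ y₁ p₂ x₂ q₂ y₂ p₁≤i q₁≤i p₂≤j q₂≤j →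
           Σᴴ²-∘μ-⊗ σ ω _ x₁ x₂ y₁ y₂ (+-mono-≤ p₁≤i p₂≤j) (+-mono-≤ q₁≤i q₂≤j)) ⟩
    ((σ ∘μ) ⋆² (ω ∘μ)) i j a b ∎
    where
    N : ℕ
    N = i +ℕ j
    regroup : ∀ u d s w → u * (d * s * w) ≈ u * d * (s * w)
    regroup = solve 4 (λ u d s w → u · ((d · s) · w) ⊜ (u · d) · (s · w)) refl

  ⊗-⋆ : ∀ σ ω σ′ ω′ i j a b → ((σ ⋆ ω) ⊗ (σ′ ⋆ ω′)) i j a b ≈ ((σ ⊗ σ′) ⋆² (ω ⊗ ω′)) i j a b
  ⊗-⋆ σ ω σ′ ω′ i j a b = begin
    (σ ⋆ ω) i a * (σ′ ⋆ ω′) j b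
      ≈⟨ *-cong (⋆-Σᴴ σ ω a ≤-refl) (⋆-Σᴴ σ′ ω′ b ≤-refl) ⟩
    Σᴴ i (λ p₁ x₁ → Σᴴ i (λ q₁ y₁ → δ i p₁ q₁ a x₁ y₁ * σ p₁ x₁ * ω q₁ y₁)) *
    Σᴴ j (λ p₂ x₂ → Σᴴ j (λ q₂ y₂ → δ j p₂ q₂ b x₂ y₂ * σ′ p₂ x₂ * ω′ q₂ y₂))
      ≈⟨ trans (*-distribʳ-Σᴴ i _ _) (Σᴴ-cong i (λ p₁ _ x₁ → trans (*-distribʳ-Σᴴ i _ _) (Σᴴ-cong i (λ q₁ _ y₁ →
           trans (*-distribˡ-Σᴴ j _ _) (Σᴴ-cong j (λ p₂ _ x₂ → trans (*-distribˡ-Σᴴ j _ _) (Σᴴ-cong j (λ q₂ _ y₂ →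
             regroup _ _ _ _ _ _)))))))) ⟩
    ((σ ⊗ σ′) ⋆² (ω ⊗ ω′)) i j a b ∎
    where
    regroup : ∀ d s w d′ s′ w′ → d * s * w * (d′ * s′ * w′) ≈ d * d′ * ((s * s′) * (w * w′))
    regroup = solve 6 (λ d s w d′ s′ w′ → ((d · s) · w) · ((d′ · s′) · w′) ⊜ (d · d′) · ((s · s′) · (w · w′))) refl

  counit-⋆ʳ² : ∀ i j a b (A : Fin (dim i) → Fin (dim j) → Carrier) →
    ΣFin (dim i) (λ x₁ → ΣFin (dim 0) (λ y₁ → ΣFin (dim j) (λ x₂ → ΣFin (dim 0) (λ y₂ →
      δ i i 0 a x₁ y₁ * δ j j 0 b x₂ y₂ * (A x₁ x₂ * (counit y₁ * counit y₂)))))) ≈ A a b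
  counit-⋆ʳ² i j a b A = begin
    ΣFin (dim i) (λ x₁ → ΣFin (dim 0) (λ y₁ → ΣFin (dim j) (λ x₂ → ΣFin (dim 0) (λ y₂ →
      δ i i 0 a x₁ y₁ * δ j j 0 b x₂ y₂ * (A x₁ x₂ * (counit y₁ * counit y₂))))))
      ≈⟨ ΣFin-cong (dim i) (λ x₁ → ΣFin-cong (dim 0) (λ y₁ → trans
           (ΣFin-cong (dim j) (λ x₂ → trans (ΣFin-cong (dim 0) (λ y₂ → regroup _ _ _ _ _)) (ΣFin-sandwich (dim 0) _ _ _)))
           (ΣFin-sandwich (dim j) _ _ _))) ⟩
    ΣFin (dim i) (λ x₁ → ΣFin (dim 0) (λ y₁ → δ i i 0 a x₁ y₁ *
      ΣFin (dim j) (λ x₂ → ΣFin (dim 0) (λ y₂ → δ j j 0 b x₂ y₂ * A x₁ x₂ * counit y₂)) * counit y₁))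
      ≈⟨ ΣFin-cong (dim i) (λ x₁ → ΣFin-cong (dim 0) (λ y₁ → *-congʳ (*-congˡ (counit-⋆ʳ j b (A x₁))))) ⟩
    ΣFin (dim i) (λ x₁ → ΣFin (dim 0) (λ y₁ → δ i i 0 a x₁ y₁ * A x₁ b * counit y₁))
      ≈⟨ counit-⋆ʳ i a (λ x₁ → A x₁ b) ⟩
    A a b ∎
    where
    regroup : ∀ d₁ d₂ x c₁ c₂ → d₁ * d₂ * (x * (c₁ * c₂)) ≈ d₁ * (d₂ * x * c₂) * c₁
    regroup = solve 5 (λ d₁ d₂ x c₁ c₂ → (d₁ · d₂) · (x · (c₁ · c₂)) ⊜ (d₁ · ((d₂ · x) · c₂)) · c₁) refl

  counit-⋆ˡ² : ∀ i j a b (B : Fin (dim i) → Fin (dim j) → Carrier) →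
    ΣFin (dim 0) (λ x₁ → ΣFin (dim i) (λ y₁ → ΣFin (dim 0) (λ x₂ → ΣFin (dim j) (λ y₂ →
      δ i 0 i a x₁ y₁ * δ j 0 j b x₂ y₂ * ((counit x₁ * counit x₂) * B y₁ y₂))))) ≈ B a b
  counit-⋆ˡ² i j a b B = begin
    ΣFin (dim 0) (λ x₁ → ΣFin (dim i) (λ y₁ → ΣFin (dim 0) (λ x₂ → ΣFin (dim j) (λ y₂ →
      δ i 0 i a x₁ y₁ * δ j 0 j b x₂ y₂ * ((counit x₁ * counit x₂) * B y₁ y₂)))))
      ≈⟨ ΣFin-cong (dim 0) (λ x₁ → ΣFin-cong (dim i) (λ y₁ → trans
           (ΣFin-cong (dim 0) (λ x₂ → trans (ΣFin-cong (dim j) (λ y₂ → regroup _ _ _ _ _)) (sym (*-distribˡ-ΣFin (dim j) _ _))))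
           (sym (*-distribˡ-ΣFin (dim 0) _ _)))) ⟩
    ΣFin (dim 0) (λ x₁ → ΣFin (dim i) (λ y₁ → δ i 0 i a x₁ y₁ * counit x₁ *
      ΣFin (dim 0) (λ x₂ → ΣFin (dim j) (λ y₂ → δ j 0 j b x₂ y₂ * counit x₂ * B y₁ y₂))))
      ≈⟨ ΣFin-cong (dim 0) (λ x₁ → ΣFin-cong (dim i) (λ y₁ → *-congˡ (counit-⋆ˡ j b (B y₁)))) ⟩
    ΣFin (dim 0) (λ x₁ → ΣFin (dim i) (λ y₁ → δ i 0 i a x₁ y₁ * counit x₁ * B y₁ b))
      ≈⟨ counit-⋆ˡ i a (λ y₁ → B y₁ b) ⟩
    B a b ∎
    where
    regroup : ∀ d₁ d₂ c₁ c₂ x → d₁ * d₂ * ((c₁ * c₂) * x) ≈ d₁ * c₁ * (d₂ * c₂ * x)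
    regroup = solve 5 (λ d₁ d₂ c₁ c₂ x → (d₁ · d₂) · ((c₁ · c₂) · x) ⊜ (d₁ · c₁) · ((d₂ · c₂) · x)) refl

  ⋆²-reduceˡ : ∀ (A B : Functional²) i j a b →
    (∀ p₁ p₂ x₁ x₂ → p₁ ≤ i → p₂ ≤ j → p₁ +ℕ p₂ < i +ℕ j → A p₁ p₂ x₁ x₂ ≈ 0#) →
    (∀ y₁ y₂ → B 0 0 y₁ y₂ ≈ counit y₁ * counit y₂) → (A ⋆² B) i j a b ≈ A i j a b
  ⋆²-reduceˡ A B i j a b A-below B₀ = begin
    (A ⋆² B) i j a b
      ≈⟨ Σ≤-single i i _ ≤-refl (λ p₁ p₁≤i p₁≢i → ΣFin-zero (dim p₁) (λ x₁ → Σᴴ-zero i (λ q₁ _ y₁ →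
           Σᴴ-zero j (λ p₂ p₂≤j x₂ → Σᴴ-zero j (λ q₂ _ y₂ →
             A-zero (A-below p₁ p₂ x₁ x₂ p₁≤i p₂≤j (+-mono-<-≤ (≤∧≢⇒< p₁≤i p₁≢i) p₂≤j))))))) ⟩
    ΣFin (dim i) (λ x₁ → Σᴴ i (λ q₁ y₁ → Σᴴ j (λ p₂ x₂ → Σᴴ j (λ q₂ y₂ → T i x₁ q₁ y₁ p₂ x₂ q₂ y₂))))
      ≈⟨ ΣFin-cong (dim i) (λ x₁ → Σᴴ-cong i (λ q₁ _ y₁ → Σ≤-single j j _ ≤-refl (λ p₂ p₂≤j p₂≢j →
           ΣFin-zero (dim p₂) (λ x₂ → Σᴴ-zero j (λ q₂ _ y₂ →
             A-zero (A-below i p₂ x₁ x₂ ≤-refl p₂≤j (+-monoʳ-< i (≤∧≢⇒< p₂≤j p₂≢j)))))))) ⟩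
    ΣFin (dim i) (λ x₁ → Σᴴ i (λ q₁ y₁ → ΣFin (dim j) (λ x₂ → Σᴴ j (λ q₂ y₂ → T i x₁ q₁ y₁ j x₂ q₂ y₂))))
      ≈⟨ ΣFin-cong (dim i) (λ x₁ → Σ≤-single i 0 _ z≤n (λ q₁ _ q₁≢0 → ΣFin-zero (dim q₁) (λ y₁ →
           ΣFin-zero (dim j) (λ x₂ → Σᴴ-zero j (λ q₂ _ y₂ → δ-off (<⇒≢ (m<m+n i (n≢0⇒n>0 q₁≢0))) _ _))))) ⟩
    ΣFin (dim i) (λ x₁ → ΣFin (dim 0) (λ y₁ → ΣFin (dim j) (λ x₂ → Σᴴ j (λ q₂ y₂ → T i x₁ 0 y₁ j x₂ q₂ y₂))))
      ≈⟨ ΣFin-cong (dim i) (λ x₁ → ΣFin-cong (dim 0) (λ y₁ → ΣFin-cong (dim j) (λ x₂ →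
           Σ≤-single j 0 _ z≤n (λ q₂ _ q₂≢0 → ΣFin-zero (dim q₂) (λ y₂ → δ₂-off (<⇒≢ (m<m+n j (n≢0⇒n>0 q₂≢0)))))))) ⟩
    ΣFin (dim i) (λ x₁ → ΣFin (dim 0) (λ y₁ → ΣFin (dim j) (λ x₂ → ΣFin (dim 0) (λ y₂ → T i x₁ 0 y₁ j x₂ 0 y₂))))
      ≈⟨ ΣFin-cong (dim i) (λ x₁ → ΣFin-cong (dim 0) (λ y₁ → ΣFin-cong (dim j) (λ x₂ → ΣFin-cong (dim 0) (λ y₂ →
           *-congˡ (*-congˡ (B₀ y₁ y₂)))))) ⟩
    ΣFin (dim i) (λ x₁ → ΣFin (dim 0) (λ y₁ → ΣFin (dim j) (λ x₂ → ΣFin (dim 0) (λ y₂ →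
      δ i i 0 a x₁ y₁ * δ j j 0 b x₂ y₂ * (A i j x₁ x₂ * (counit y₁ * counit y₂))))))
      ≈⟨ counit-⋆ʳ² i j a b (A i j) ⟩
    A i j a b ∎
    where
    T : Functional⁴
    T p₁ x₁ q₁ y₁ p₂ x₂ q₂ y₂ = δ i p₁ q₁ a x₁ y₁ * δ j p₂ q₂ b x₂ y₂ * (A p₁ p₂ x₁ x₂ * B q₁ q₂ y₁ y₂)
    A-zero : ∀ {d₁ d₂ x y} → x ≈ 0# → d₁ * d₂ * (x * y) ≈ 0#
    A-zero x≈0 = trans (*-congˡ (trans (*-congʳ x≈0) (zeroˡ _))) (zeroʳ _)
    δ₂-off : ∀ {d p q x y X} → j ≢ p +ℕ q → d * δ j p q b x y * X ≈ 0#
    δ₂-off {d} {p} {q} {x} {y} {X} j≢p+q = trans (*-congʳ (trans (*-congˡ (δ-graded j p q b x y j≢p+q)) (zeroʳ d))) (zeroˡ X)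

  ⋆²-reduceʳ : ∀ (A B : Functional²) i j a b →
    (∀ x₁ x₂ → A 0 0 x₁ x₂ ≈ counit x₁ * counit x₂) →
    (∀ q₁ q₂ y₁ y₂ → q₁ ≤ i → q₂ ≤ j → q₁ +ℕ q₂ < i +ℕ j → B q₁ q₂ y₁ y₂ ≈ 0#) → (A ⋆² B) i j a b ≈ B i j a b
  ⋆²-reduceʳ A B i j a b A₀ B-below = begin
    (A ⋆² B) i j a b
      ≈⟨ Σᴴ-cong i (λ p₁ _ x₁ → Σ≤-single i i _ ≤-refl (λ q₁ q₁≤i q₁≢i → ΣFin-zero (dim q₁) (λ y₁ →
           Σᴴ-zero j (λ p₂ _ x₂ → Σᴴ-zero j (λ q₂ q₂≤j y₂ →
             B-zero (B-below q₁ q₂ y₁ y₂ q₁≤i q₂≤j (+-mono-<-≤ (≤∧≢⇒< q₁≤i q₁≢i) q₂≤j))))))) ⟩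
    Σᴴ i (λ p₁ x₁ → ΣFin (dim i) (λ y₁ → Σᴴ j (λ p₂ x₂ → Σᴴ j (λ q₂ y₂ → T p₁ x₁ i y₁ p₂ x₂ q₂ y₂))))
      ≈⟨ Σᴴ-cong i (λ p₁ _ x₁ → ΣFin-cong (dim i) (λ y₁ → Σᴴ-cong j (λ p₂ _ x₂ → Σ≤-single j j _ ≤-refl (λ q₂ q₂≤j q₂≢j →
           ΣFin-zero (dim q₂) (λ y₂ → B-zero (B-below i q₂ y₁ y₂ ≤-refl q₂≤j (+-monoʳ-< i (≤∧≢⇒< q₂≤j q₂≢j)))))))) ⟩
    Σᴴ i (λ p₁ x₁ → ΣFin (dim i) (λ y₁ → Σᴴ j (λ p₂ x₂ → ΣFin (dim j) (λ y₂ → T p₁ x₁ i y₁ p₂ x₂ j y₂))))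
      ≈⟨ Σ≤-single i 0 _ z≤n (λ p₁ _ p₁≢0 → ΣFin-zero (dim p₁) (λ x₁ → ΣFin-zero (dim i) (λ y₁ →
           Σᴴ-zero j (λ p₂ _ x₂ → ΣFin-zero (dim j) (λ y₂ → δ-off (<⇒≢ (m<n+m i (n≢0⇒n>0 p₁≢0))) _ _))))) ⟩
    ΣFin (dim 0) (λ x₁ → ΣFin (dim i) (λ y₁ → Σᴴ j (λ p₂ x₂ → ΣFin (dim j) (λ y₂ → T 0 x₁ i y₁ p₂ x₂ j y₂))))
      ≈⟨ ΣFin-cong (dim 0) (λ x₁ → ΣFin-cong (dim i) (λ y₁ → Σ≤-single j 0 _ z≤n (λ p₂ _ p₂≢0 →
           ΣFin-zero (dim p₂) (λ x₂ → ΣFin-zero (dim j) (λ y₂ → δ₂-off (<⇒≢ (m<n+m j (n≢0⇒n>0 p₂≢0)))))))) ⟩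
    ΣFin (dim 0) (λ x₁ → ΣFin (dim i) (λ y₁ → ΣFin (dim 0) (λ x₂ → ΣFin (dim j) (λ y₂ → T 0 x₁ i y₁ 0 x₂ j y₂))))
      ≈⟨ ΣFin-cong (dim 0) (λ x₁ → ΣFin-cong (dim i) (λ y₁ → ΣFin-cong (dim 0) (λ x₂ → ΣFin-cong (dim j) (λ y₂ →
           *-congˡ (*-congʳ (A₀ x₁ x₂)))))) ⟩
    ΣFin (dim 0) (λ x₁ → ΣFin (dim i) (λ y₁ → ΣFin (dim 0) (λ x₂ → ΣFin (dim j) (λ y₂ →
      δ i 0 i a x₁ y₁ * δ j 0 j b x₂ y₂ * ((counit x₁ * counit x₂) * B i j y₁ y₂)))))
      ≈⟨ counit-⋆ˡ² i j a b (B i j) ⟩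
    B i j a b ∎
    where
    T : Functional⁴
    T p₁ x₁ q₁ y₁ p₂ x₂ q₂ y₂ = δ i p₁ q₁ a x₁ y₁ * δ j p₂ q₂ b x₂ y₂ * (A p₁ p₂ x₁ x₂ * B q₁ q₂ y₁ y₂)
    B-zero : ∀ {d₁ d₂ x y} → y ≈ 0# → d₁ * d₂ * (x * y) ≈ 0#
    B-zero y≈0 = trans (*-congˡ (trans (*-congˡ y≈0) (zeroʳ _))) (zeroʳ _)
    δ₂-off : ∀ {d p q x y X} → j ≢ p +ℕ q → d * δ j p q b x y * X ≈ 0#
    δ₂-off {d} {p} {q} {x} {y} {X} j≢p+q = trans (*-congʳ (trans (*-congˡ (δ-graded j p q b x y j≢p+q)) (zeroʳ d))) (zeroˡ X)

  ⋆²-distribʳ : ∀ {A A₁ A₂} B i j a b → (∀ p q x y → A p q x y ≈ A₁ p q x y + A₂ p q x y) →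
                (A ⋆² B) i j a b ≈ (A₁ ⋆² B) i j a b + (A₂ ⋆² B) i j a b
  ⋆²-distribʳ B i j a b A≈A₁+A₂ = trans (ΣΔΔ-cong i j (λ p₁ x₁ q₁ y₁ p₂ x₂ q₂ y₂ _ _ _ _ →
    trans (*-congˡ (trans (*-congʳ (A≈A₁+A₂ p₁ p₂ x₁ x₂)) (distribʳ _ _ _))) (distribˡ _ _ _))) (ΣΔΔ-distrib-+ i j _ _)

  ⋆²-distribˡ : ∀ A {B B₁ B₂} i j a b → (∀ p q x y → B p q x y ≈ B₁ p q x y + B₂ p q x y) →
                (A ⋆² B) i j a b ≈ (A ⋆² B₁) i j a b + (A ⋆² B₂) i j a b
  ⋆²-distribˡ A i j a b B≈B₁+B₂ = trans (ΣΔΔ-cong i j (λ p₁ x₁ q₁ y₁ p₂ x₂ q₂ y₂ _ _ _ _ →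
    trans (*-congˡ (trans (*-congˡ (B≈B₁+B₂ q₁ q₂ y₁ y₂)) (distribˡ _ _ _))) (distribˡ _ _ _))) (ΣΔΔ-distrib-+ i j _ _)

  defect : Functional → Functional²
  defect φ i j a b = (φ ∘μ) i j a b - (φ ⊗ φ) i j a b

  MultiplicativeBelow : ℕ → Functional → Set ℓ
  MultiplicativeBelow N φ = ∀ i j a b → i +ℕ j < N → (φ ∘μ) i j a b ≈ (φ ⊗ φ) i j a b

  ∘μ-normalised : ∀ {φ} → Normalised φ → ∀ x y → (φ ∘μ) 0 0 x y ≈ counit x * counit y
  ∘μ-normalised φ₀ x y = trans (ΣFin-cong (dim 0) (λ z → *-congˡ (φ₀ z))) (counit-mult 0 0 x y)

  ⊗-normalised : ∀ {φ} → Normalised φ → ∀ x y → (φ ⊗ φ) 0 0 x y ≈ counit x * counit y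
  ⊗-normalised φ₀ x y = *-cong (φ₀ x) (φ₀ y)

  -- Write σ ∘μ = σ ⊗ σ + defect σ, likewise for ω, in (σ ∘μ) ⋆² (ω ∘μ).  The defects vanish below
  -- degree i + j, so each survives only against the degree-0 part of the other factor, which is ε ⊗ ε.
  defect-⋆ : ∀ {σ ω} i j a b → Normalised σ → Normalised ω →
             MultiplicativeBelow (i +ℕ j) σ → MultiplicativeBelow (i +ℕ j) ω →
             defect (σ ⋆ ω) i j a b ≈ defect σ i j a b + defect ω i j a b
  defect-⋆ {σ} {ω} i j a b σ₀ ω₀ σ-mult ω-mult = begin
    ((σ ⋆ ω) ∘μ) i j a b - ((σ ⋆ ω) ⊗ (σ ⋆ ω)) i j a b
      ≈⟨ +-congʳ (∘μ-⋆ σ ω i j a b) ⟩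
    ((σ ∘μ) ⋆² (ω ∘μ)) i j a b - P
      ≈⟨ +-congʳ (⋆²-distribˡ (σ ∘μ) i j a b (λ p q x y → sym (y+[x-y]≈x ((ω ∘μ) p q x y) _))) ⟩
    ((σ ∘μ) ⋆² (ω ⊗ ω)) i j a b + ((σ ∘μ) ⋆² defect ω) i j a b - P
      ≈⟨ +-congʳ (+-cong (⋆²-distribʳ (ω ⊗ ω) i j a b (λ p q x y → sym (y+[x-y]≈x ((σ ∘μ) p q x y) _)))
                        (⋆²-reduceʳ (σ ∘μ) (defect ω) i j a b (∘μ-normalised {σ} σ₀) (defect-below ω-mult))) ⟩
    ((σ ⊗ σ) ⋆² (ω ⊗ ω)) i j a b + (defect σ ⋆² (ω ⊗ ω)) i j a b + defect ω i j a b - P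
      ≈⟨ +-congʳ (+-congʳ (+-cong (sym (⊗-⋆ σ ω σ ω i j a b))
                                  (⋆²-reduceˡ (defect σ) (ω ⊗ ω) i j a b (defect-below σ-mult) (⊗-normalised {ω} ω₀)))) ⟩
    P + defect σ i j a b + defect ω i j a b - P
      ≈⟨ +-congʳ (+-assoc _ _ _) ⟩
    P + (defect σ i j a b + defect ω i j a b) - P
      ≈⟨ xyx⁻¹≈y P _ ⟩
    defect σ i j a b + defect ω i j a b ∎
    where
    P : Carrier
    P = ((σ ⋆ ω) ⊗ (σ ⋆ ω)) i j a b
    defect-below : ∀ {φ} → MultiplicativeBelow (i +ℕ j) φ →
                   ∀ p q x y → p ≤ i → q ≤ j → p +ℕ q < i +ℕ j → defect φ p q x y ≈ 0#
    defect-below φ-mult p q x y _ _ p+q<i+j = x≈y⇒x∙y⁻¹≈ε (φ-mult p q x y p+q<i+j)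

  multiplicative-by-induction : ∀ {φ} → (∀ i j a b → MultiplicativeBelow (i +ℕ j) φ → defect φ i j a b ≈ 0#) →
                                Multiplicative φ
  multiplicative-by-induction {φ} step i j a b = below (suc (i +ℕ j)) i j a b (n<1+n _)
    where
    below : ∀ N → MultiplicativeBelow N φ
    below zero    i j a b ()
    below (suc N) i j a b i+j<1+N with m<1+n⇒m<n∨m≡n i+j<1+N
    ... | inj₁ i+j<N  = below N i j a b i+j<N
    ... | inj₂ ≡-refl = x∙y⁻¹≈ε⇒x≈y _ _ (step i j a b (below N))

  ⋆-normalised : ∀ {φ ψ} → Normalised φ → Normalised ψ → Normalised (φ ⋆ ψ)
  ⋆-normalised {φ} {ψ} φ₀ ψ₀ a = trans (⋆-vanishingʳ φ ψ 0 a ψ₀ (λ _ ())) (φ₀ a)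

  ⋆-character : ∀ {φ ψ} → IsCharacter φ → IsCharacter ψ → IsCharacter (φ ⋆ ψ)
  ⋆-character {φ} {ψ} χ@(φ-mult , _) ξ@(ψ-mult , _) =
    normalised-multiplicative⇒character (⋆-normalised {φ} {ψ} φ₀ ψ₀) (multiplicative-by-induction (λ i j a b _ → begin
      defect (φ ⋆ ψ) i j a b                ≈⟨ defect-⋆ i j a b φ₀ ψ₀ (λ p q x y _ → φ-mult p q x y) (λ p q x y _ → ψ-mult p q x y) ⟩
      defect φ i j a b + defect ψ i j a b   ≈⟨ +-cong (x≈y⇒x∙y⁻¹≈ε (φ-mult i j a b)) (x≈y⇒x∙y⁻¹≈ε (ψ-mult i j a b)) ⟩
      0# + 0#                               ≈⟨ +-identityˡ 0# ⟩
      0#                                    ∎))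
    where
    φ₀ : Normalised φ
    φ₀ = character⇒normalised χ
    ψ₀ : Normalised ψ
    ψ₀ = character⇒normalised ξ

  ⋆-characterˡ : ∀ {σ ω} → Normalised σ → IsCharacter ω → IsCharacter (σ ⋆ ω) → IsCharacter σ
  ⋆-characterˡ {σ} {ω} σ₀ ξ@(ω-mult , _) (σω-mult , _) =
    normalised-multiplicative⇒character σ₀ (multiplicative-by-induction (λ i j a b σ-mult-below → begin
      defect σ i j a b                       ≈⟨ +-identityʳ _ ⟨
      defect σ i j a b + 0#                  ≈⟨ +-congˡ (x≈y⇒x∙y⁻¹≈ε (ω-mult i j a b)) ⟨
      defect σ i j a b + defect ω i j a b    ≈⟨ defect-⋆ i j a b σ₀ (character⇒normalised ξ) σ-mult-below (λ p q x y _ → ω-mult p q x y) ⟨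
      defect (σ ⋆ ω) i j a b                 ≈⟨ x≈y⇒x∙y⁻¹≈ε (σω-mult i j a b) ⟩
      0#                                     ∎))

  character-resp : ∀ {φ ψ} → φ ≋ ψ → IsCharacter φ → IsCharacter ψ
  character-resp {φ} {ψ} φ≋ψ (φ-mult , φ-unit) = ψ-mult , trans (ΣFin-cong (dim 0) (λ a → *-congˡ (sym (φ≋ψ 0 a)))) φ-unit
    where
    ψ-mult : Multiplicative ψ
    ψ-mult i j a b = trans (Σᴴ-cong (i +ℕ j) (λ m _ z → *-congˡ (sym (φ≋ψ m z))))
                           (trans (φ-mult i j a b) (*-cong (φ≋ψ i a) (φ≋ψ j b)))

  ⁻¹-normalised : ∀ {φ} → IsCharacter φ → Normalised (φ ⁻¹)
  ⁻¹-normalised {φ} χ a = trans (sym (⋆-vanishingʳ (φ ⁻¹) φ 0 a (character⇒normalised χ) (λ _ ()))) (⁻¹-inverseˡ χ 0 a)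

  ⁻¹-character : ∀ {φ} → IsCharacter φ → IsCharacter (φ ⁻¹)
  ⁻¹-character {φ} χ = ⋆-characterˡ (⁻¹-normalised χ) χ (character-resp (λ n a → sym (⁻¹-inverseˡ χ n a)) ε̃-character)

  bar-character : ∀ {φ} → IsCharacter φ → IsCharacter (bar φ)
  bar-character {φ} (φ-mult , φ-unit) = bar-mult , trans (ΣFin-cong (dim 0) (λ a → *-congˡ (*-identityˡ _))) φ-unit
    where
    bar-mult : Multiplicative (bar φ)
    bar-mult i j a b = begin
      Σᴴ (i +ℕ j) (λ m z → μ i j m a b z * (sgn m * φ m z))
        ≈⟨ Σᴴ-cong (i +ℕ j) (λ m _ z → sign-out m z) ⟩
      Σᴴ (i +ℕ j) (λ m z → sgn (i +ℕ j) * (μ i j m a b z * φ m z))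
        ≈⟨ *-distribˡ-Σᴴ (i +ℕ j) _ _ ⟨
      sgn (i +ℕ j) * (φ ∘μ) i j a b
        ≈⟨ *-cong (sgn-+ i j) (φ-mult i j a b) ⟩
      (sgn i * sgn j) * (φ i a * φ j b)
        ≈⟨ *-interchange _ _ _ _ ⟩
      (sgn i * φ i a) * (sgn j * φ j b) ∎
      where
      sign-out : ∀ m z → μ i j m a b z * (sgn m * φ m z) ≈ sgn (i +ℕ j) * (μ i j m a b z * φ m z)
      sign-out m z with m ≟ i +ℕ j
      ... | yes ≡-refl = x∙yz≈y∙xz _ _ _
      ... | no m≢i+j   = trans (trans (*-congʳ μ≈0) (zeroˡ _)) (sym (trans (*-congˡ (trans (*-congʳ μ≈0) (zeroˡ _))) (zeroʳ _)))
        where μ≈0 = μ-graded i j m a b z m≢i+j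

module Halves {c ℓ} (F : Field c ℓ) (char≢2 : CharNot2 F) where
  open Field F
  open import Relation.Binary.Reasoning.Setoid setoid

  ½ : Carrier
  ½ = proj₁ (inverse (1# + 1#) char≢2)

  ½+½≈1 : ½ + ½ ≈ 1#
  ½+½≈1 = begin
    ½ + ½                  ≈⟨ +-cong (*-identityˡ ½) (*-identityˡ ½) ⟨
    1# * ½ + 1# * ½        ≈⟨ distribʳ ½ 1# 1# ⟨
    (1# + 1#) * ½          ≈⟨ proj₂ (inverse (1# + 1#) char≢2) ⟩
    1#                     ∎

  ½x+½x≈x : ∀ x → ½ * x + ½ * x ≈ x
  ½x+½x≈x x = trans (sym (distribʳ x ½ ½)) (trans (*-congʳ ½+½≈1) (*-identityˡ x))

  x+x≈0⇒x≈0 : ∀ {x} → x + x ≈ 0# → x ≈ 0#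
  x+x≈0⇒x≈0 {x} x+x≈0 = begin
    x                  ≈⟨ ½x+½x≈x x ⟨
    ½ * x + ½ * x      ≈⟨ distribˡ ½ x x ⟨
    ½ * (x + x)        ≈⟨ *-congˡ x+x≈0 ⟩
    ½ * 0#             ≈⟨ zeroʳ ½ ⟩
    0#                 ∎

module SquareRoots {c ℓ} {F : Field c ℓ} (char≢2 : CharNot2 F) (H : GCHopf F) where
  open Field F hiding (zero)
  open Sums F
  open SumsProperties F using (y+[x-y]≈x)
  open GCHopf H
  open Characters H
  open Convolution H
  open CharacterTheory H
  open Halves F char≢2
  open import Algebra.Properties.Group +-group using (x≈y⇒x∙y⁻¹≈ε; x∙y⁻¹≈ε⇒x≈y; identityʳ-unique) renaming (ε⁻¹≈ε to -0#≈0#)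
  open import Relation.Binary.Reasoning.Setoid setoid

  ⋆-square-injective : ∀ {α β} → Normalised α → Normalised β → (α ⋆ α) ≋ (β ⋆ β) → α ≋ β
  ⋆-square-injective {α} {β} α₀ β₀ αα≋ββ = <-rec (λ n → ∀ a → α n a ≈ β n a) step
    where
    step : ∀ n → (∀ {m} → m < n → ∀ a → α m a ≈ β m a) → ∀ a → α n a ≈ β n a
    step n α≈β-below e = x∙y⁻¹≈ε⇒x≈y _ _ (x+x≈0⇒x≈0 (identityʳ-unique _ _ (begin
      (β ⋆ β) n e + ((α n e - β n e) + (α n e - β n e))
        ≈⟨ ⋆-square-top α β n e α₀ β₀ (λ m m<n → α≈β-below m<n) ⟨
      (α ⋆ α) n e
        ≈⟨ αα≋ββ n e ⟩
      (β ⋆ β) n e ∎)))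

  ⋆-square-character : ∀ {σ} → Normalised σ → IsCharacter (σ ⋆ σ) → IsCharacter σ
  ⋆-square-character {σ} σ₀ (σσ-mult , _) =
    normalised-multiplicative⇒character σ₀ (multiplicative-by-induction (λ i j a b σ-mult-below →
      x+x≈0⇒x≈0 (trans (sym (defect-⋆ i j a b σ₀ σ₀ σ-mult-below σ-mult-below)) (x≈y⇒x∙y⁻¹≈ε (σσ-mult i j a b)))))

  module SquareRootConstruction (τ : Functional) (τ₀ : Normalised τ) where

    -- Adding c in degree k+1 changes the square by 2c there (⋆-square-top), hence the factor ½.
    approx : ℕ → Functional
    approx zero    = ε̃
    approx (suc k) m e with m ≟ suc k
    ... | yes _ = ½ * (τ m e - (approx k ⋆ approx k) m e)
    ... | no  _ = approx k m e

    approx-top : ∀ k e → approx (suc k) (suc k) e ≡ ½ * (τ (suc k) e - (approx k ⋆ approx k) (suc k) e)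
    approx-top k e with suc k ≟ suc k
    ... | yes _   = ≡-refl
    ... | no  k≢k = ⊥-elim (k≢k ≡-refl)

    approx-other : ∀ k m e → m ≢ suc k → approx (suc k) m e ≡ approx k m e
    approx-other k m e m≢1+k with m ≟ suc k
    ... | yes m≡1+k = ⊥-elim (m≢1+k m≡1+k)
    ... | no  _     = ≡-refl

    approx-above : ∀ k m e → k < m → approx k m e ≈ 0#
    approx-above zero    (suc m) e _   = refl
    approx-above (suc k) m       e k<m =
      trans (reflexive (approx-other k m e (λ m≡1+k → <-irrefl (sym-≡ m≡1+k) k<m))) (approx-above k m e (<-trans (n<1+n k) k<m))

    approx-normalised : ∀ k → Normalised (approx k)
    approx-normalised zero    e = refl
    approx-normalised (suc k) e = trans (reflexive (approx-other k 0 e (λ ()))) (approx-normalised k e)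

    approx-stable : ∀ k m e → m ≤ k → approx k m e ≈ approx m m e
    approx-stable zero    zero e z≤n = refl
    approx-stable (suc k) m    e m≤1+k with m ≟ suc k
    ... | yes ≡-refl = reflexive (sym-≡ (approx-top k e))
    ... | no  m≢1+k  = approx-stable k m e (≤-pred (≤∧≢⇒< m≤1+k m≢1+k))

    approx-square : ∀ k e → (approx k ⋆ approx k) k e ≈ τ k e
    approx-square zero    e = trans (⋆-identityˡ ε̃ 0 e) (sym (τ₀ e))
    approx-square (suc k) e = begin
      (approx (suc k) ⋆ approx (suc k)) (suc k) e
        ≈⟨ ⋆-square-top (approx (suc k)) (approx k) (suc k) e (approx-normalised (suc k)) (approx-normalised k)
             (λ m m<1+k b → reflexive (approx-other k m b (λ m≡1+k → <-irrefl m≡1+k m<1+k))) ⟩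
      (approx k ⋆ approx k) (suc k) e + (correction + correction)
        ≈⟨ +-congˡ (+-cong correction≈½residual correction≈½residual) ⟩
      (approx k ⋆ approx k) (suc k) e + (½ * residual + ½ * residual)
        ≈⟨ +-congˡ (½x+½x≈x residual) ⟩
      (approx k ⋆ approx k) (suc k) e + residual
        ≈⟨ y+[x-y]≈x (τ (suc k) e) _ ⟩
      τ (suc k) e ∎
      where
      residual : Carrier
      residual = τ (suc k) e - (approx k ⋆ approx k) (suc k) e
      correction : Carrier
      correction = approx (suc k) (suc k) e - approx k (suc k) e
      correction≈½residual : correction ≈ ½ * residual
      correction≈½residual = trans (+-cong (reflexive (approx-top k e)) (trans (-‿cong (approx-above k (suc k) e (n<1+n k))) -0#≈0#))
                            (+-identityʳ _)

    √τ : Functional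
    √τ m e = approx m m e

    √τ-square : (√τ ⋆ √τ) ≋ τ
    √τ-square n e = trans (⋆-cong-≤ n stable stable e) (approx-square n e)
      where
      stable : ∀ m → m ≤ n → ∀ a → √τ m a ≈ approx n m a
      stable m m≤n a = sym (approx-stable n m a m≤n)

  square-root : ∀ τ → Normalised τ → ∃ λ σ → Normalised σ × (σ ⋆ σ) ≋ τ
  square-root τ τ₀ = √τ , (λ a → approx-normalised 0 a) , √τ-square
    where open SquareRootConstruction τ τ₀

module CharacterGroup {c ℓ} {F : Field c ℓ} (H : GCHopf F) where
  open Field F using (refl; sym; trans)
  open GCHopf H using (ε̃)
  open Characters H
  open Convolution H
  open CharacterTheory H

  Character : Set (c ⊔ ℓ)
  Character = Σ Functional IsCharacter

  characterGroup : Group _ ℓ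
  characterGroup = record
    { Carrier = Character
    ; _≈_     = λ φ ψ → proj₁ φ ≋ proj₁ ψ
    ; _∙_     = λ φ ψ → proj₁ φ ⋆ proj₁ ψ , ⋆-character (proj₂ φ) (proj₂ ψ)
    ; ε       = ε̃ , ε̃-character
    ; _⁻¹     = λ φ → proj₁ φ ⁻¹ , ⁻¹-character (proj₂ φ)
    ; isGroup = record
      { isMonoid = record
        { isSemigroup = record
          { isMagma = record
            { isEquivalence = record
              { refl  = λ n a → refl
              ; sym   = λ φ≋ψ n a → sym (φ≋ψ n a)
              ; trans = λ φ≋ψ ψ≋χ n a → trans (φ≋ψ n a) (ψ≋χ n a)
              }
            ; ∙-cong = ⋆-cong
            }
          ; assoc = λ φ ψ χ → ⋆-assoc (proj₁ φ) (proj₁ ψ) (proj₁ χ)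
          }
        ; identity = (λ φ → ⋆-identityˡ (proj₁ φ)) , (λ φ → ⋆-identityʳ (proj₁ φ))
        }
      ; inverse = (λ φ → ⁻¹-inverseˡ (proj₂ φ)) , (λ φ → ⁻¹-inverseʳ (proj₂ φ))
      ; ⁻¹-cong = ⁻¹-cong
      }
    }

  open Group characterGroup using (rawGroup; _≈_)

  θ : Character → Character
  θ φ = bar (proj₁ φ) , bar-character (proj₂ φ)

  θ-isGroupHomomorphism : IsGroupHomomorphism rawGroup rawGroup θ
  θ-isGroupHomomorphism = record
    { isMonoidHomomorphism = record
      { isMagmaHomomorphism = record
        { isRelHomomorphism = record { cong = bar-cong }
        ; homo = λ φ ψ → bar-⋆ (proj₁ φ) (proj₁ ψ)
        }
      ; ε-homo = bar-ε̃
      }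
    ; ⁻¹-homo = λ φ → bar-⁻¹ (proj₁ φ)
    }

  open GroupTheory characterGroup public using (_·_)
  open GroupTheory.EvenOdd characterGroup θ θ-isGroupHomomorphism public

  θ-involutive : Involutive _≈_ θ
  θ-involutive φ = bar-bar (proj₁ φ)

  proj₁-· : ∀ k φ → proj₁ (k · φ) ≡ proj₁ φ ^ℕ k
  proj₁-· zero    φ = ≡-refl
  proj₁-· (suc k) φ = cong (proj₁ φ ⋆_) (proj₁-· k φ)

-- For a character φ, Odd (φ , _) and Even (φ , _) unfold to the second components of X₋ φ and X₊ φ.
module OddCharacters {c ℓ} {F : Field c ℓ} (char≢2 : CharNot2 F) (H : GCHopf F) where
  open Characters H
  open CharacterTheory H using (character⇒normalised; character-resp; ⋆-character; ⁻¹-character)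
  open CharacterGroup H
  open Group characterGroup using (_≈_; _∙_)
  open SquareRoots char≢2 H
  open Field F using (sym)

  character-square-injective : ∀ φ ψ → φ ∙ φ ≈ ψ ∙ ψ → φ ≈ ψ
  character-square-injective (φ , χ) (ψ , ξ) = ⋆-square-injective (character⇒normalised χ) (character⇒normalised ξ)

  character-square-root : ∀ φ → ∃ λ ψ → ψ ∙ ψ ≈ φ
  character-square-root (φ , χ) with square-root φ (character⇒normalised χ)
  ... | ψ , ψ₀ , ψψ≋φ = (ψ , ⋆-square-character ψ₀ (character-resp (λ n a → sym (ψψ≋φ n a)) χ)) , ψψ≋φ

  open Uniqueness character-square-injective
  open Existence character-square-injective θ-involutive character-square-root

  X₋-factorˡ : ∀ φ → IsCharacter φ → ∃ λ ψ → ∃ λ ρ → X₋ ψ × X₊ ρ × (φ ≋ (ψ ⋆ ρ))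
  X₋-factorˡ φ χ = repack (odd-even-factorˡ (φ , χ))
    where
    repack : (∃₂ λ ψ ρ → Odd ψ × Even ρ × (φ , χ) ≈ ψ ∙ ρ) → ∃ λ ψ → ∃ λ ρ → X₋ ψ × X₊ ρ × (φ ≋ (ψ ⋆ ρ))
    repack ((ψ , χψ) , (ρ , χρ) , odd-ψ , even-ρ , φ≋ψρ) = ψ , ρ , (χψ , odd-ψ) , (χρ , even-ρ) , φ≋ψρ

  X₋-factorʳ : ∀ φ → IsCharacter φ → ∃ λ ψ → ∃ λ ρ → X₋ ψ × X₊ ρ × (φ ≋ (ρ ⋆ ψ))
  X₋-factorʳ φ χ = repack (odd-even-factorʳ (φ , χ))
    where
    repack : (∃₂ λ ψ ρ → Odd ψ × Even ρ × (φ , χ) ≈ ρ ∙ ψ) → ∃ λ ψ → ∃ λ ρ → X₋ ψ × X₊ ρ × (φ ≋ (ρ ⋆ ψ))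
    repack ((ψ , χψ) , (ρ , χρ) , odd-ψ , even-ρ , φ≋ρψ) = ψ , ρ , (χψ , odd-ψ) , (χρ , even-ρ) , φ≋ρψ

  X₋-uniqueˡ : ∀ ψ ψ′ ρ → X₋ ψ → X₋ ψ′ → X₊ ρ → ψ′ ≋ (ψ ⋆ ρ) → ψ ≋ ψ′
  X₋-uniqueˡ ψ ψ′ ρ (χψ , odd-ψ) (χψ′ , odd-ψ′) (χρ , even-ρ) =
    odd-even-uniqueˡ {ψ , χψ} {ψ′ , χψ′} {ρ , χρ} odd-ψ odd-ψ′ even-ρ

  X₋-uniqueʳ : ∀ ψ ψ′ ρ → X₋ ψ → X₋ ψ′ → X₊ ρ → ψ′ ≋ (ρ ⋆ ψ) → ψ ≋ ψ′
  X₋-uniqueʳ ψ ψ′ ρ (χψ , odd-ψ) (χψ′ , odd-ψ′) (χρ , even-ρ) =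
    odd-even-uniqueʳ {ψ , χψ} {ψ′ , χψ′} {ρ , χρ} odd-ψ odd-ψ′ even-ρ

  X₋-conjugate : ∀ ρ ψ → X₊ ρ → X₋ ψ → X₋ ((ρ ⋆ ψ) ⋆ (ρ ⁻¹))
  X₋-conjugate ρ ψ (χρ , even-ρ) (χψ , odd-ψ) =
    ⋆-character (⋆-character χρ χψ) (⁻¹-character χρ) , odd-conjugate {ρ , χρ} {ψ , χψ} even-ρ odd-ψ

  X₋-⋆-comm : ∀ φ ψ → X₋ φ → X₋ ψ → (φ ⋆ ψ) ≋ (ψ ⋆ φ) → X₋ (φ ⋆ ψ)
  X₋-⋆-comm φ ψ (χφ , odd-φ) (χψ , odd-ψ) φψ≋ψφ =
    ⋆-character χφ χψ , odd-∙-comm {φ , χφ} {ψ , χψ} odd-φ odd-ψ φψ≋ψφ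

  X₋-⁻¹ : ∀ ψ → X₋ ψ → X₋ (ψ ⁻¹)
  X₋-⁻¹ ψ (χ , odd-ψ) = ⁻¹-character χ , odd-⁻¹ {ψ , χ} odd-ψ

  X₋-^ℕ : ∀ ψ k → X₋ ψ → X₋ (ψ ^ℕ k)
  X₋-^ℕ ψ k (χ , odd-ψ) = subst X₋ (proj₁-· k (ψ , χ)) (proj₂ (k · (ψ , χ)) , odd-· {ψ , χ} odd-ψ k)

  X₋-^ℤ : ∀ ψ z → X₋ ψ → X₋ (ψ ^ℤ z)
  X₋-^ℤ ψ (+ k)     odd-ψ = X₋-^ℕ ψ k odd-ψ
  X₋-^ℤ ψ -[1+ k ]  odd-ψ = X₋-^ℕ (ψ ⁻¹) (suc k) (X₋-⁻¹ ψ odd-ψ)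

proposition1p7 : ∀ {c ℓ} (F : Field c ℓ) → CharNot2 F → (H : GCHopf F) →
    let open Characters H in
    -- X₋ is a set of representatives of the left cosets φ X₊
    ((∀ φ → IsCharacter φ → ∃ λ ψ → ∃ λ ρ → X₋ ψ × X₊ ρ × (φ ≋ (ψ ⋆ ρ)))
      × (∀ ψ ψ′ ρ → X₋ ψ → X₋ ψ′ → X₊ ρ → ψ′ ≋ (ψ ⋆ ρ) → ψ ≋ ψ′))
    -- X₋ is a set of representatives of the right cosets X₊ φ
    × ((∀ φ → IsCharacter φ → ∃ λ ψ → ∃ λ ρ → X₋ ψ × X₊ ρ × (φ ≋ (ρ ⋆ ψ)))
      × (∀ ψ ψ′ ρ → X₋ ψ → X₋ ψ′ → X₊ ρ → ψ′ ≋ (ρ ⋆ ψ) → ψ ≋ ψ′))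
    -- (a) closed under conjugation by even characters
    × (∀ ρ ψ → X₊ ρ → X₋ ψ → X₋ ((ρ ⋆ ψ) ⋆ (ρ ⁻¹)))
    -- (b) commuting odd characters have odd product
    × (∀ φ ψ → X₋ φ → X₋ ψ → (φ ⋆ ψ) ≋ (ψ ⋆ φ) → X₋ (φ ⋆ ψ))
    -- (c) closed under integer powers, in particular under inversion
    × (∀ ψ (z : ℤ) → X₋ ψ → X₋ (ψ ^ℤ z))
    × (∀ ψ → X₋ ψ → X₋ (ψ ⁻¹))
proposition1p7 F char≢2 H =
    (X₋-factorˡ , X₋-uniqueˡ) , (X₋-factorʳ , X₋-uniqueʳ) , X₋-conjugate , X₋-⋆-comm , X₋-^ℤ , X₋-⁻¹
  where open OddCharacters char≢2 H
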